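{- Let $G$ be the $r\times n$ rectangular graph with vertex set $V=\{(i,j)\mid 1\le i\le r,\ 1\le j\le n\}$, ordered lexicographically, and let $\delta:V\to\mathbb Z_{\ge 0}$ be any map. Then the number of even orientations of $G$ that contain a cyclic triangle and in which every vertex $v$ has out-degree $\delta(v)$ equals the number of odd orientations of $G$ that contain a cyclic triangle and in which every vertex $v$ has out-degree $\delta(v)$.
   Context: The $r\times n$ rectangular graph has vertex set $\{(i,j)\mid 1\le i\le r,1\le j\le n\}$, two distinct vertices being adjacent precisely when they agree in the first coordinate or in the second coordinate. An orientation of $G$ is a directed graph with the same vertices and edges, each edge given a direction. For a graph with totally ordered vertex set, an edge directed $v\leftarrow w$ (i.e. from $w$ to $v$) with $v<w$ is called inverted; an orientation is even if its number of inverted edges is even and odd otherwise. A cyclic triangle is a set of three vertices $u,v,w$ with directed edges $u\to v\to w\to u$. -}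

module Defs where

open import Data.Nat using (ℕ; zero; suc; _≡ᵇ_)
open import Data.Nat.Base using (_%_)
open import Data.Bool using (Bool; true; false; _∧_; _∨_; not; if_then_else_)
open import Data.Fin using (Fin)
open import Data.Fin.Properties using () renaming (_≟_ to _≟F_)
open import Data.Fin.Properties using () renaming (_<?_ to _<?F_)
open import Data.Product using (_×_; _,_; proj₁; proj₂)
open import Data.List using (List; []; _∷_; length; filter; map; concatMap; allFin; zipWith)
open import Data.Bool.ListAction using (any; all)
open import Data.Vec using (Vec; []; _∷_; toList)
open import Relation.Nullary using (does)
open import Relation.Nullary.Decidable using (⌊_⌋)
open import Relation.Binary.PropositionalEquality using (_≡_)

-- Vertices of the r × n rectangular graph: (i , j) with i : Fin r, j : Fin n
-- (0-based indices standing for 1..r and 1..n).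
V : ℕ → ℕ → Set
V r n = Fin r × Fin n

allV : (r n : ℕ) → List (V r n)
allV r n = concatMap (λ i → map (λ j → (i , j)) (allFin n)) (allFin r)

_==V_ : ∀ {r n} → V r n → V r n → Bool
(i , j) ==V (i' , j') = does (i ≟F i') ∧ does (j ≟F j')

_<V_ : ∀ {r n} → V r n → V r n → Bool
(i , j) <V (i' , j') = does (i <?F i') ∨ (does (i ≟F i') ∧ does (j <?F j'))

adjacent : ∀ {r n} → V r n → V r n → Bool
adjacent (i , j) (i' , j') =
  not ((i , j) ==V (i' , j')) ∧ (does (i ≟F i') ∨ does (j ≟F j'))

edges : (r n : ℕ) → List (V r n × V r n)
edges r n =
  concatMap (λ v → map (λ w → (v , w))
                       (filter (λ w → Data.Bool.T? (adjacent v w ∧ (v <V w))) (allV r n)))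
            (allV r n)
  where import Data.Bool

-- An orientation assigns a Bool to each edge (v , w), v < w, in the order of 'edges':
--   false : the edge is directed v → w (not inverted)
--   true  : the edge is directed v ← w, i.e. from w to v (inverted)
-- This is a bijective encoding of orientations of G.
record Orientation (r n : ℕ) : Set where
  constructor orient
  field
    dirs : Vec Bool (length (edges r n))
open Orientation public

allVecs : (m : ℕ) → List (Vec Bool m)
allVecs zero = [] ∷ []
allVecs (suc m) = concatMap (λ b → map (b ∷_) (allVecs m)) (true ∷ false ∷ [])

allOrientations : (r n : ℕ) → List (Orientation r n)
allOrientations r n = map orient (allVecs (length (edges r n)))

arcs : ∀ {r n} → Orientation r n → List (V r n × V r n)
arcs {r} {n} o =
  zipWith (λ e b → if b then (proj₂ e , proj₁ e) else (proj₁ e , proj₂ e))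
          (edges r n) (toList (dirs o))

inversions : ∀ {r n} → Orientation r n → ℕ
inversions o = length (filter (λ b → Data.Bool.T? b) (toList (dirs o)))
  where import Data.Bool

isEven : ℕ → Bool
isEven k = (k % 2) ≡ᵇ 0

evenOrientation : ∀ {r n} → Orientation r n → Bool
evenOrientation o = isEven (inversions o)

oddOrientation : ∀ {r n} → Orientation r n → Bool
oddOrientation o = not (isEven (inversions o))

arc : ∀ {r n} → Orientation r n → V r n → V r n → Bool
arc o u v = any (λ a → (proj₁ a ==V u) ∧ (proj₂ a ==V v)) (arcs o)

outdeg : ∀ {r n} → Orientation r n → V r n → ℕ
outdeg o v = length (filter (λ a → Data.Bool.T? (proj₁ a ==V v)) (arcs o))
  where import Data.Bool

hasCyclicTriangle : ∀ {r n} → Orientation r n → Bool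
hasCyclicTriangle {r} {n} o =
  any (λ u → any (λ v → any (λ w → arc o u v ∧ arc o v w ∧ arc o w u)
                             (allV r n)) (allV r n)) (allV r n)

hasOutdegrees : ∀ {r n} → (V r n → ℕ) → Orientation r n → Bool
hasOutdegrees {r} {n} δ o = all (λ v → outdeg o v ≡ᵇ δ v) (allV r n)

numOrientations : (r n : ℕ) → (Orientation r n → Bool) → ℕ
numOrientations r n P = length (filter (λ o → Data.Bool.T? (P o)) (allOrientations r n))
  where import Data.Bool

-- Every triangle of the rectangular graph lies in a row or a column, and a tournament contains a
-- cyclic triangle exactly when two of its vertices have the same score. Hence an orientation has a
-- cyclic triangle exactly when some edge uv is balanced: u and v have equally many out-neighbours on
-- the line through them. At the first balanced edge uv, relabel the orientation on that line by the
-- transposition of u and v. This preserves every line score, hence all out-degrees and the first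
-- balanced edge, so it is an involution on the orientations with a cyclic triangle. It reverses uv
-- and, for every w on the line that u and v treat differently, both uw and vw: an odd number of
-- edges, so it exchanges even and odd orientations.

module Submission where

open import Defs
open import Data.Nat using (ℕ; zero; suc; _+_; _*_; _≤_; _<_; z≤n; s≤s; _≡ᵇ_) renaming (_≟_ to _≟ℕ_)
open import Data.Nat.Properties
  using ( ≤-refl; 1+n≰n; ≤-trans; ≤-reflexive; <-irrefl; ≤∧≢⇒<; ≤-pred; m≤n+m; m≤m+n; n≤0⇒n≡0
        ; +-cancelˡ-≤; +-mono-≤; +-mono-<-≤; +-mono-≤-<; +-assoc; +-identityʳ; +-suc; suc-injective; +-comm
        ; *-cancelˡ-≡; *-zeroʳ; *-identityʳ; *-comm; *-assoc; *-distribˡ-+; +-commutativeSemigroup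
        ; ≡ᵇ⇒≡; ≡⇒≡ᵇ; module ≤-Reasoning )
open import Data.Nat.DivMod using (_%_; [m+n]%n≡m%n)
open import Data.Nat.Solver using (module +-*-Solver)
open import Algebra.Properties.CommutativeSemigroup +-commutativeSemigroup using (interchange)
open import Data.Bool using (Bool; true; false; not; _∧_; _∨_; _xor_; if_then_else_; T) renaming (_≟_ to _≟𝔹_)
open import Data.Bool.Properties
  using ( T-≡; not-involutive; ∧-zeroʳ; ∨-identityʳ; true-xor; not-distribˡ-xor
        ; xor-comm; xor-same; xor-inverseʳ; xor-annihilates-not )
open import Data.List using (List; []; _∷_; _++_; length; filter; map; concatMap; allFin; upTo; zipWith; findᵇ)
open import Data.List.Properties using (length-++; length-upTo; filter-≐)
open import Data.List.Relation.Unary.Any.Properties using (any⁺; any⁻)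
open import Data.Maybe using (Maybe; just; nothing)
open import Data.Fin using (Fin) renaming (_<_ to _<ᶠ_)
import Data.Fin.Properties as Fin
open import Data.List.Relation.Unary.Any using (here; there; any?)
open import Data.List.Relation.Unary.All using (All; []; _∷_)
import Data.List.Relation.Unary.All as All
open import Data.List.Relation.Unary.AllPairs using ([]; _∷_)
open import Data.List.Relation.Unary.Unique.Propositional using (Unique)
import Data.List.Relation.Unary.Unique.Propositional.Properties as Unique
open import Data.List.Membership.Propositional using (_∈_; lose; find)
open import Data.List.Membership.Propositional.Properties
  using (∈-∃++; ∈-++⁺ˡ; ∈-++⁺ʳ; ∈-++⁻; ∈-filter⁺; ∈-filter⁻; ∈-upTo⁺; ∈-allFin)
open import Data.Bool.ListAction using (any; all)
open import Data.Product using (∃; _×_; _,_; proj₁; proj₂; uncurry; swap)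
open import Data.Product.Properties using (,-injective)
open import Data.Product.Relation.Binary.Lex.Strict using (×-Lex; ×-decidable; ×-isStrictTotalOrder)
open import Data.Product.Relation.Binary.Pointwise.NonDependent using (≡×≡⇒≡)
open import Data.Sum using (_⊎_; inj₁; inj₂) renaming (map to ⊎-map)
open import Data.Empty using (⊥; ⊥-elim)
open import Data.Vec using (Vec; []; _∷_; toList)
import Data.Vec.Properties as Vecₚ
open import Function using (_∘_)
open import Function.Bundles using (Equivalence; mk⇔)
open import Relation.Nullary using (¬_; Dec; yes; no; does; contradiction; ¬?)
open import Relation.Nullary.Decidable using (T?; dec-true; dec-false; does-⇔; map′; _×-dec_; _⊎-dec_)
open import Relation.Binary.Definitions using (DecidableEquality; tri<; tri≈; tri>)
open import Relation.Binary.Structures using (IsStrictTotalOrder)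
open import Relation.Binary.PropositionalEquality
  using (_≡_; _≢_; refl; sym; trans; cong; cong₂; subst; subst₂; module ≡-Reasoning)

⟦_⟧ : Bool → ℕ
⟦ true ⟧ = 1
⟦ false ⟧ = 0

⟦⟧≤1 : ∀ b → ⟦ b ⟧ ≤ 1
⟦⟧≤1 true = ≤-refl
⟦⟧≤1 false = z≤n

⟦b⟧+⟦not-b⟧≡1 : ∀ b → ⟦ b ⟧ + ⟦ not b ⟧ ≡ 1
⟦b⟧+⟦not-b⟧≡1 true = refl
⟦b⟧+⟦not-b⟧≡1 false = refl

∧≡true : ∀ {p q} → p ∧ q ≡ true → p ≡ true × q ≡ true
∧≡true {true} q≡true = refl , q≡true

if-then-0-cong : ∀ c {a b : ℕ} → (c ≡ true → a ≡ b) → (if c then a else 0) ≡ (if c then b else 0)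
if-then-0-cong true a≡b = a≡b refl
if-then-0-cong false _ = refl

if-0-else-cong : ∀ c {a b : ℕ} → (c ≡ false → a ≡ b) → (if c then 0 else a) ≡ (if c then 0 else b)
if-0-else-cong true _ = refl
if-0-else-cong false a≡b = a≡b refl

⟦⟧-pair : ∀ e p q → (if e then ⟦ p ⟧ else 0) + (if e then ⟦ q ⟧ else 0)
                    ≡ 2 * (if e then ⟦ p ∧ q ⟧ else 0) + (if e then ⟦ p xor q ⟧ else 0)
⟦⟧-pair false p q = refl
⟦⟧-pair true true true = refl
⟦⟧-pair true true false = refl
⟦⟧-pair true false true = refl
⟦⟧-pair true false false = refl

+-double-injective : ∀ x y → x + x ≡ y + y → x ≡ y
+-double-injective x y x+x≡y+y = *-cancelˡ-≡ x y 2
  (trans (cong (x +_) (+-identityʳ x)) (trans x+x≡y+y (sym (cong (y +_) (+-identityʳ y)))))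

⟦∧⟧ : ∀ p q → ⟦ p ∧ q ⟧ ≡ ⟦ p ⟧ * ⟦ q ⟧
⟦∧⟧ true q = sym (+-identityʳ ⟦ q ⟧)
⟦∧⟧ false q = refl

does-sound : ∀ {P : Set} (p? : Dec P) → does p? ≡ true → P
does-sound (yes p) _ = p

-- Finite sums

∑ : {A : Set} → List A → (A → ℕ) → ℕ
∑ [] f = 0
∑ (x ∷ xs) f = f x + ∑ xs f

infix 5 ∑
syntax ∑ xs (λ x → e) = ∑[ x ∈ xs ] e

module _ {A : Set} where

  ∑-cong : ∀ xs {f g : A → ℕ} → (∀ x → f x ≡ g x) → ∑ xs f ≡ ∑ xs g
  ∑-cong [] e = refl
  ∑-cong (x ∷ xs) e = cong₂ _+_ (e x) (∑-cong xs e)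

  ∑-zero : ∀ (xs : List A) → ∑[ x ∈ xs ] 0 ≡ 0
  ∑-zero [] = refl
  ∑-zero (x ∷ xs) = ∑-zero xs

  ∑-+ : ∀ xs (f g : A → ℕ) → ∑[ x ∈ xs ] (f x + g x) ≡ ∑ xs f + ∑ xs g
  ∑-+ [] f g = refl
  ∑-+ (x ∷ xs) f g =
    trans (cong (f x + g x +_) (∑-+ xs f g)) (interchange (f x) (g x) (∑ xs f) (∑ xs g))

  ∑-*ˡ : ∀ xs c (f : A → ℕ) → ∑[ x ∈ xs ] (c * f x) ≡ c * ∑ xs f
  ∑-*ˡ [] c f = sym (*-zeroʳ c)
  ∑-*ˡ (x ∷ xs) c f = trans (cong (c * f x +_) (∑-*ˡ xs c f)) (sym (*-distribˡ-+ c (f x) (∑ xs f)))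

  ∑-++ : ∀ xs ys (f : A → ℕ) → ∑ (xs ++ ys) f ≡ ∑ xs f + ∑ ys f
  ∑-++ [] ys f = refl
  ∑-++ (x ∷ xs) ys f = trans (cong (f x +_) (∑-++ xs ys f)) (sym (+-assoc (f x) _ _))

  ∑-filter : ∀ {P : A → Set} (P? : ∀ x → Dec (P x)) xs f →
    ∑ (filter P? xs) f ≡ ∑[ x ∈ xs ] (if does (P? x) then f x else 0)
  ∑-filter P? [] f = refl
  ∑-filter P? (x ∷ xs) f with does (P? x)
  ... | true = cong (f x +_) (∑-filter P? xs f)
  ... | false = ∑-filter P? xs f

  length-filter : ∀ {P : A → Set} (P? : ∀ x → Dec (P x)) xs →
    length (filter P? xs) ≡ ∑[ x ∈ xs ] ⟦ does (P? x) ⟧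
  length-filter P? [] = refl
  length-filter P? (x ∷ xs) with does (P? x)
  ... | true = cong suc (length-filter P? xs)
  ... | false = length-filter P? xs

  length≡∑1 : ∀ (xs : List A) → length xs ≡ ∑[ x ∈ xs ] 1
  length≡∑1 [] = refl
  length≡∑1 (x ∷ xs) = cong suc (length≡∑1 xs)

  ∑-mono-≤ : ∀ xs {f g : A → ℕ} → (∀ {x} → x ∈ xs → f x ≤ g x) → ∑ xs f ≤ ∑ xs g
  ∑-mono-≤ [] h = z≤n
  ∑-mono-≤ (x ∷ xs) h = +-mono-≤ (h (here refl)) (∑-mono-≤ xs (h ∘ there))

  ∑-mono-< : ∀ {xs} {f g : A → ℕ} → (∀ {x} → x ∈ xs → f x ≤ g x) →
    ∀ {y} → y ∈ xs → f y < g y → ∑ xs f < ∑ xs g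
  ∑-mono-< {x ∷ xs} h (here refl) lt = +-mono-<-≤ lt (∑-mono-≤ xs (h ∘ there))
  ∑-mono-< {x ∷ xs} h (there y∈xs) lt = +-mono-≤-< (h (here refl)) (∑-mono-< (h ∘ there) y∈xs lt)

  any-from-count : ∀ xs (p : A → Bool) b → ∑[ x ∈ xs ] ⟦ p x ⟧ ≡ ⟦ b ⟧ → any p xs ≡ b
  any-from-count [] p false _ = refl
  any-from-count (x ∷ xs) p b count≡ with p x
  any-from-count (x ∷ xs) p true _ | true = refl
  ... | false = any-from-count xs p b count≡

  any-true : ∀ {xs} (p : A → Bool) {x} → x ∈ xs → p x ≡ true → any p xs ≡ true
  any-true p x∈ px = Equivalence.to T-≡ (any⁺ p (lose x∈ (Equivalence.from T-≡ px)))

  any-witness : ∀ xs (p : A → Bool) → any p xs ≡ true → ∃ λ x → x ∈ xs × p x ≡ true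
  any-witness xs p any≡true =
    let x , x∈ , px = find (any⁻ p xs (Equivalence.from T-≡ any≡true)) in x , x∈ , Equivalence.to T-≡ px

  findᵇ-just : ∀ xs {p : A → Bool} {y} → findᵇ p xs ≡ just y → y ∈ xs × p y ≡ true
  findᵇ-just (x ∷ xs) {p} found with p x in px
  findᵇ-just (x ∷ xs) refl | true = here refl , px
  ... | false = let y∈ , py = findᵇ-just xs found in there y∈ , py

  findᵇ-nothing : ∀ xs {p : A → Bool} {y} → findᵇ p xs ≡ nothing → y ∈ xs → p y ≡ false
  findᵇ-nothing (x ∷ xs) {p} none y∈ with p x in px
  findᵇ-nothing (x ∷ xs) () y∈ | true
  findᵇ-nothing (x ∷ xs) none (here refl) | false = px
  findᵇ-nothing (x ∷ xs) none (there y∈) | false = findᵇ-nothing xs none y∈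

  findᵇ-cong : ∀ xs {p q : A → Bool} → (∀ {x} → x ∈ xs → p x ≡ q x) → findᵇ p xs ≡ findᵇ q xs
  findᵇ-cong [] _ = refl
  findᵇ-cong (x ∷ xs) p≡q rewrite p≡q (here refl) | findᵇ-cong xs (p≡q ∘ there) = refl

  ∑-partition : ∀ xs (p : A → Bool) (f : A → ℕ) →
    ∑ xs f ≡ (∑[ x ∈ xs ] (if p x then f x else 0)) + (∑[ x ∈ xs ] (if p x then 0 else f x))
  ∑-partition xs p f = trans (∑-cong xs pointwise) (∑-+ xs _ _)
    where
    pointwise : ∀ x → f x ≡ (if p x then f x else 0) + (if p x then 0 else f x)
    pointwise x with p x
    ... | true = sym (+-identityʳ (f x))
    ... | false = refl

  all-cong : ∀ xs {p q : A → Bool} → (∀ x → p x ≡ q x) → all p xs ≡ all q xs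
  all-cong [] _ = refl
  all-cong (x ∷ xs) p≗q = cong₂ _∧_ (p≗q x) (all-cong xs p≗q)

module _ {A B : Set} where

  ∑-map : ∀ xs (h : A → B) f → ∑ (map h xs) f ≡ ∑[ x ∈ xs ] f (h x)
  ∑-map [] h f = refl
  ∑-map (x ∷ xs) h f = cong (f (h x) +_) (∑-map xs h f)

  ∑-concatMap : ∀ xs (h : A → List B) f → ∑ (concatMap h xs) f ≡ ∑[ x ∈ xs ] ∑ (h x) f
  ∑-concatMap [] h f = refl
  ∑-concatMap (x ∷ xs) h f =
    trans (∑-++ (h x) (concatMap h xs) f) (cong (∑ (h x) f +_) (∑-concatMap xs h f))

  ∑-swap : ∀ xs ys (f : A → B → ℕ) → ∑[ x ∈ xs ] ∑[ y ∈ ys ] f x y ≡ ∑[ y ∈ ys ] ∑[ x ∈ xs ] f x y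
  ∑-swap [] ys f = sym (∑-zero ys)
  ∑-swap (x ∷ xs) ys f =
    trans (cong (∑ ys (f x) +_) (∑-swap xs ys f)) (sym (∑-+ ys (f x) (λ y → ∑[ x′ ∈ xs ] f x′ y)))

module Listing {A : Set} (_≟_ : DecidableEquality A) where

  δ : A → A → ℕ
  δ x y = ⟦ does (x ≟ y) ⟧

  count : A → List A → ℕ
  count x xs = ∑[ y ∈ xs ] δ y x

  IsListing : List A → Set
  IsListing xs = ∀ x → count x xs ≡ 1

  δ-refl : ∀ x → δ x x ≡ 1
  δ-refl x = cong ⟦_⟧ (dec-true (x ≟ x) refl)

  δ-≢ : ∀ {x y} → x ≢ y → δ x y ≡ 0
  δ-≢ {x} {y} x≢y = cong ⟦_⟧ (dec-false (x ≟ y) x≢y)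

  δ-sym : ∀ x y → δ x y ≡ δ y x
  δ-sym x y with x ≟ y | y ≟ x
  ... | yes _ | yes _ = refl
  ... | no _ | no _ = refl
  ... | yes x≡y | no y≢x = contradiction (sym x≡y) y≢x
  ... | no x≢y | yes y≡x = contradiction (sym y≡x) x≢y

  δ-*-comm : ∀ y x (f : A → ℕ) → δ y x * f y ≡ f x * δ y x
  δ-*-comm y x f with y ≟ x
  ... | yes refl = *-comm 1 (f y)
  ... | no _ = sym (*-zeroʳ (f x))

  module _ {xs} (listing : IsListing xs) where

    ∑-δ : ∀ x (f : A → ℕ) → ∑[ y ∈ xs ] δ y x * f y ≡ f x
    ∑-δ x f = begin
      ∑[ y ∈ xs ] δ y x * f y ≡⟨ ∑-cong xs (λ y → δ-*-comm y x f) ⟩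
      ∑[ y ∈ xs ] f x * δ y x ≡⟨ ∑-*ˡ xs (f x) (λ y → δ y x) ⟩
      f x * count x xs        ≡⟨ cong (f x *_) (listing x) ⟩
      f x * 1                 ≡⟨ *-identityʳ (f x) ⟩
      f x                     ∎
      where open ≡-Reasoning

    ∑-δ² : ∀ x y (F : A → A → ℕ) → ∑[ a ∈ xs ] ∑[ b ∈ xs ] δ a x * (δ b y * F a b) ≡ F x y
    ∑-δ² x y F = trans
      (∑-cong xs (λ a → trans (∑-*ˡ xs (δ a x) (λ b → δ b y * F a b)) (cong (δ a x *_) (∑-δ y (F a)))))
      (∑-δ x (λ a → F a y))

    ∑-involution : (ψ : A → A) → (∀ x → ψ (ψ x) ≡ x) → (f : A → ℕ) → ∑[ x ∈ xs ] f (ψ x) ≡ ∑ xs f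
    ∑-involution ψ involutive f = begin
      ∑[ x ∈ xs ] f (ψ x)
        ≡⟨ ∑-cong xs (λ x → sym (∑-δ (ψ x) f)) ⟩
      ∑[ x ∈ xs ] ∑[ y ∈ xs ] δ y (ψ x) * f y
        ≡⟨ ∑-swap xs xs _ ⟩
      ∑[ y ∈ xs ] ∑[ x ∈ xs ] δ y (ψ x) * f y
        ≡⟨ ∑-cong xs (λ y → ∑-cong xs (λ x → cong (_* f y) (δ-ψ y x))) ⟩
      ∑[ y ∈ xs ] ∑[ x ∈ xs ] δ x (ψ y) * f y
        ≡⟨ ∑-cong xs (λ y → ∑-δ (ψ y) (λ _ → f y)) ⟩
      ∑[ y ∈ xs ] f y ∎
      where
      open ≡-Reasoning
      δ-ψ : ∀ y x → δ y (ψ x) ≡ δ x (ψ y)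
      δ-ψ y x with y ≟ ψ x | x ≟ ψ y
      ... | yes _ | yes _ = refl
      ... | no _ | no _ = refl
      ... | yes refl | no x≢ψy = contradiction (sym (involutive x)) x≢ψy
      ... | no y≢ψx | yes refl = contradiction (sym (involutive y)) y≢ψx

  ∈⇒count≥1 : ∀ {x xs} → x ∈ xs → 1 ≤ count x xs
  ∈⇒count≥1 {x} {y ∷ ys} (here refl) = ≤-trans (≤-reflexive (sym (δ-refl x))) (m≤m+n (δ x x) _)
  ∈⇒count≥1 {x} {y ∷ ys} (there x∈ys) = ≤-trans (∈⇒count≥1 x∈ys) (m≤n+m _ (δ y x))

  count≥1⇒∈ : ∀ {x} xs → 1 ≤ count x xs → x ∈ xs
  count≥1⇒∈ {x} (y ∷ ys) 1≤count with y ≟ x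
  ... | yes refl = here refl
  ... | no _ = there (count≥1⇒∈ ys 1≤count)

  ∉⇒count≡0 : ∀ {x xs} → All (x ≢_) xs → count x xs ≡ 0
  ∉⇒count≡0 [] = refl
  ∉⇒count≡0 {x} {y ∷ ys} (x≢y ∷ x∉ys) = trans (cong (_+ count x ys) (δ-≢ (x≢y ∘ sym))) (∉⇒count≡0 x∉ys)

  count≡0⇒∉ : ∀ {x} xs → count x xs ≡ 0 → All (x ≢_) xs
  count≡0⇒∉ [] _ = []
  count≡0⇒∉ {x} (y ∷ ys) count≡0 with y ≟ x
  ... | no y≢x = (y≢x ∘ sym) ∷ count≡0⇒∉ ys count≡0

  Unique⇒count≡1 : ∀ {x xs} → Unique xs → x ∈ xs → count x xs ≡ 1
  Unique⇒count≡1 {x} (x∉ys ∷ _) (here refl) = cong₂ _+_ (δ-refl x) (∉⇒count≡0 x∉ys)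
  Unique⇒count≡1 {x} {y ∷ ys} (y∉ys ∷ u) (there x∈ys) =
    cong₂ _+_ (δ-≢ (λ y≡x → All.lookup y∉ys x∈ys y≡x)) (Unique⇒count≡1 u x∈ys)

  count≤1⇒Unique : ∀ xs → (∀ x → count x xs ≤ 1) → Unique xs
  count≤1⇒Unique [] _ = []
  count≤1⇒Unique (y ∷ ys) count≤1 =
    count≡0⇒∉ ys (n≤0⇒n≡0 (+-cancelˡ-≤ 1 _ _ (subst (λ k → k + count y ys ≤ 1) (δ-refl y) (count≤1 y))))
    ∷ count≤1⇒Unique ys (λ x → ≤-trans (m≤n+m _ (δ y x)) (count≤1 x))

  IsListing⇒∈ : ∀ {xs} → IsListing xs → ∀ x → x ∈ xs
  IsListing⇒∈ {xs} listing x = count≥1⇒∈ xs (≤-reflexive (sym (listing x)))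

  IsListing⇒Unique : ∀ {xs} → IsListing xs → Unique xs
  IsListing⇒Unique {xs} listing = count≤1⇒Unique xs (≤-reflexive ∘ listing)

module _ {A B : Set} (_≟A_ : DecidableEquality A) (_≟B_ : DecidableEquality B) where

  _≟×_ : DecidableEquality (A × B)
  (a , b) ≟× (a′ , b′) = map′ (uncurry (cong₂ _,_)) ,-injective ((a ≟A a′) ×-dec (b ≟B b′))

  private
    module LA = Listing _≟A_
    module LB = Listing _≟B_
    module L× = Listing _≟×_

  δ-× : ∀ a b a′ b′ → L×.δ (a , b) (a′ , b′) ≡ LA.δ a a′ * LB.δ b b′
  δ-× a b a′ b′ = ⟦∧⟧ (does (a ≟A a′)) (does (b ≟B b′))

  ∑-cartesianProduct : ∀ xs ys (f : A × B → ℕ) →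
    ∑ (concatMap (λ a → map (a ,_) ys) xs) f ≡ ∑[ a ∈ xs ] ∑[ b ∈ ys ] f (a , b)
  ∑-cartesianProduct xs ys f =
    trans (∑-concatMap xs _ f) (∑-cong xs (λ a → ∑-map ys (a ,_) f))

  cartesianProduct-isListing : ∀ {xs ys} → LA.IsListing xs → LB.IsListing ys →
    L×.IsListing (concatMap (λ a → map (a ,_) ys) xs)
  cartesianProduct-isListing {xs} {ys} xs-listing ys-listing (a , b) = begin
    ∑ (concatMap (λ a′ → map (a′ ,_) ys) xs) (λ p → L×.δ p (a , b))
      ≡⟨ ∑-cartesianProduct xs ys _ ⟩
    ∑[ a′ ∈ xs ] ∑[ b′ ∈ ys ] L×.δ (a′ , b′) (a , b)
      ≡⟨ ∑-cong xs (λ a′ → ∑-cong ys (λ b′ → trans (δ-× a′ b′ a b) (*-comm (LA.δ a′ a) _))) ⟩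
    ∑[ a′ ∈ xs ] ∑[ b′ ∈ ys ] LB.δ b′ b * LA.δ a′ a
      ≡⟨ ∑-cong xs (λ a′ → LB.∑-δ {ys} ys-listing b (λ _ → LA.δ a′ a)) ⟩
    LA.count a xs
      ≡⟨ xs-listing a ⟩
    1 ∎
    where open ≡-Reasoning

allFin-isListing : ∀ k → Listing.IsListing (Fin._≟_ {k}) (allFin k)
allFin-isListing k x = Listing.Unique⇒count≡1 Fin._≟_ (Unique.allFin⁺ k) (∈-allFin x)

vecMap : ∀ {A B : Set} → (A → B) → (xs : List A) → Vec B (length xs)
vecMap f [] = []
vecMap f (x ∷ xs) = f x ∷ vecMap f xs

module _ {A B : Set} where

  toList-vecMap : ∀ (f : A → B) xs → toList (vecMap f xs) ≡ map f xs
  toList-vecMap f [] = refl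
  toList-vecMap f (x ∷ xs) = cong (f x ∷_) (toList-vecMap f xs)

  vecMap-cong : ∀ xs {f g : A → B} → (∀ {x} → x ∈ xs → f x ≡ g x) → vecMap f xs ≡ vecMap g xs
  vecMap-cong [] _ = refl
  vecMap-cong (x ∷ xs) f≡g = cong₂ _∷_ (f≡g (here refl)) (vecMap-cong xs (f≡g ∘ there))

module Orienting {A : Set} (_≟_ : DecidableEquality A) where

  _≟²_ : DecidableEquality (A × A)
  _≟²_ = _≟_ ≟× _≟_

  open Listing _≟²_ public using () renaming (δ to δ²; count to count²)

  orientEdge : A × A → Bool → A × A
  orientEdge e inverted = if inverted then (proj₂ e , proj₁ e) else (proj₁ e , proj₂ e)

  arcsOf : (es : List (A × A)) → Vec Bool (length es) → List (A × A)
  arcsOf es bits = zipWith orientEdge es (toList bits)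

  hasArc : List (A × A) → A → A → Bool
  hasArc as x y = any (λ a → does (a ≟² (x , y))) as

  arcsOf-vecMap : ∀ es (g : A × A → Bool) → arcsOf es (vecMap g es) ≡ map (λ e → orientEdge e (g e)) es
  arcsOf-vecMap [] g = refl
  arcsOf-vecMap (e ∷ es) g = cong (orientEdge e (g e) ∷_) (arcsOf-vecMap es g)

  δ²-orientEdge : ∀ e b p → δ² (orientEdge e b) p ≡ δ² e p * ⟦ not b ⟧ + δ² e (swap p) * ⟦ b ⟧
  δ²-orientEdge (a , b) true (x , y) = begin
    δ² (b , a) (x , y)  ≡⟨ δ-× _≟_ _≟_ b a x y ⟩
    δ b x * δ a y       ≡⟨ *-comm (δ b x) (δ a y) ⟩
    δ a y * δ b x       ≡⟨ sym (δ-× _≟_ _≟_ a b y x) ⟩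
    δ² (a , b) (y , x)  ≡⟨ sym (cong₂ _+_ (*-zeroʳ (δ² (a , b) (x , y))) (*-identityʳ (δ² (a , b) (y , x)))) ⟩
    δ² (a , b) (x , y) * 0 + δ² (a , b) (y , x) * 1 ∎
    where
    open ≡-Reasoning
    open Listing _≟_ using (δ)
  δ²-orientEdge (a , b) false (x , y) = sym (trans
    (cong₂ _+_ (*-identityʳ (δ² (a , b) (x , y))) (*-zeroʳ (δ² (a , b) (y , x)))) (+-identityʳ _))

  orientEdge-≢ : ∀ {e p} b → e ≢ p → e ≢ swap p → does (orientEdge e b ≟² p) ≡ false
  orientEdge-≢ {e} {p} true _ e≢p̄ = dec-false (_ ≟² p) (λ ē≡p → e≢p̄ (cong swap ē≡p))
  orientEdge-≢ {e} {p} false e≢p _ = dec-false (_ ≟² p) e≢p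

  orientEdge-reversed : ∀ {e} b → e ≢ swap e → does (orientEdge e b ≟² swap e) ≡ b
  orientEdge-reversed {e} true _ = dec-true (_ ≟² swap e) refl
  orientEdge-reversed {e} false e≢ē = dec-false (_ ≟² swap e) e≢ē

  hasArc-avoiding : ∀ es bits {p} → (∀ {e} → e ∈ es → e ≢ p × e ≢ swap p) →
    hasArc (arcsOf es bits) (proj₁ p) (proj₂ p) ≡ false
  hasArc-avoiding [] [] _ = refl
  hasArc-avoiding (e ∷ es) (b ∷ bits) avoids = cong₂ _∨_
    (uncurry (orientEdge-≢ b) (avoids (here refl))) (hasArc-avoiding es bits (avoids ∘ there))

  module _ {xs} (listing : Listing.IsListing _≟_ xs) where
    open Listing _≟_ using (δ; δ-sym; ∑-δ)

    ∑-tails : ∀ as v → ∑[ a ∈ as ] δ (proj₁ a) v ≡ ∑[ w ∈ xs ] count² (v , w) as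
    ∑-tails as v = sym (trans (∑-swap xs as _) (∑-cong as tails))
      where
      tails : ∀ a → ∑[ w ∈ xs ] δ² a (v , w) ≡ δ (proj₁ a) v
      tails (a , b) = trans
        (∑-cong xs (λ w → trans (δ-× _≟_ _≟_ a b v w) (trans (*-comm (δ a v) (δ b w)) (cong (_* δ a v) (δ-sym b w)))))
        (∑-δ {xs} listing b (λ _ → δ a v))

  bits-recovered : ∀ es (bits : Vec Bool (length es)) → Unique es →
    (∀ {e e′} → e ∈ es → e′ ∈ es → e′ ≢ swap e) →
    vecMap (λ e → hasArc (arcsOf es bits) (proj₂ e) (proj₁ e)) es ≡ bits
  bits-recovered [] [] _ _ = refl
  bits-recovered (e ∷ es) (b ∷ bits) (e∉es ∷ unique) no-reversal = cong₂ _∷_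
    (trans (cong₂ _∨_ (orientEdge-reversed b (no-reversal (here refl) (here refl)))
                      (hasArc-avoiding es bits λ e′∈ →
                         (no-reversal (here refl) (there e′∈)) , (λ e′≡e → All.lookup e∉es e′∈ (sym e′≡e))))
           (∨-identityʳ b))
    (trans (vecMap-cong es λ {e′} e′∈ →
              cong (_∨ hasArc (arcsOf es bits) (proj₂ e′) (proj₁ e′))
                   (orientEdge-≢ b (no-reversal (there e′∈) (here refl)) (All.lookup e∉es e′∈)))
           (bits-recovered es bits unique (λ e∈ e′∈ → no-reversal (there e∈) (there e′∈))))

∈-++-skip : ∀ {A : Set} {v w : A} ys {zs} → v ∈ ys ++ w ∷ zs → v ≢ w → v ∈ ys ++ zs
∈-++-skip ys v∈ v≢w with ∈-++⁻ ys v∈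
... | inj₁ v∈ys = ∈-++⁺ˡ v∈ys
... | inj₂ (here v≡w) = contradiction v≡w v≢w
... | inj₂ (there v∈zs) = ∈-++⁺ʳ ys v∈zs

module _ {A B : Set} (f : A → B) where

  pigeonhole : ∀ {xs ks} → Unique xs → (∀ {a b} → a ∈ xs → b ∈ xs → f a ≡ f b → a ≡ b) →
    (∀ {a} → a ∈ xs → f a ∈ ks) → length xs ≤ length ks
  pigeonhole {[]} _ _ _ = z≤n
  pigeonhole {x ∷ xs} (x∉xs ∷ u) injective into with ∈-∃++ (into (here refl))
  ... | ys , zs , refl = begin
    suc (length xs)              ≤⟨ s≤s (pigeonhole u (λ a∈ b∈ → injective (there a∈) (there b∈)) into′) ⟩
    suc (length (ys ++ zs))      ≡⟨ cong suc (length-++ ys) ⟩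
    suc (length ys + length zs)  ≡⟨ sym (+-suc (length ys) (length zs)) ⟩
    length ys + suc (length zs)  ≡⟨ sym (length-++ ys) ⟩
    length (ys ++ f x ∷ zs)      ∎
    where
    open ≤-Reasoning
    into′ : ∀ {a} → a ∈ xs → f a ∈ ys ++ zs
    into′ a∈xs = ∈-++-skip ys (into (there a∈xs))
      (λ fa≡fx → All.lookup x∉xs a∈xs (sym (injective (there a∈xs) (here refl) fa≡fx)))

-- Scores in tournaments

module Tournament {A : Set} (_≟_ : DecidableEquality A) where
  open Listing _≟_

  score : List A → (A → A → Bool) → A → ℕ
  score xs D x = ∑[ w ∈ xs ] ⟦ D x w ⟧

  record IsTournamentOn (xs : List A) (D : A → A → Bool) : Set where
    field
      irreflexive : ∀ x → D x x ≡ false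
      opposite    : ∀ {x y} → x ∈ xs → y ∈ xs → x ≢ y → D y x ≡ not (D x y)

    arc⇒≢ : ∀ {x y} → D x y ≡ true → x ≢ y
    arc⇒≢ {x} Dxy refl = contradiction (trans (sym Dxy) (irreflexive x)) λ ()

    arc⇒no-converse : ∀ {x y} → x ∈ xs → y ∈ xs → D x y ≡ true → D y x ≡ false
    arc⇒no-converse x∈ y∈ Dxy = trans (opposite x∈ y∈ (arc⇒≢ Dxy)) (cong not Dxy)

  ScoresDistinct : List A → (A → A → Bool) → Set
  ScoresDistinct xs D = ∀ {a b} → a ∈ xs → b ∈ xs → score xs D a ≡ score xs D b → a ≡ b

  module _ {xs D} (tournament : IsTournamentOn xs D) where
    open IsTournamentOn tournament

    -- Without a 2-path y → w → x, x beats everything y beats, and y as well.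
    score-drop : ∀ {x y} → x ∈ xs → y ∈ xs → D x y ≡ true →
      (∀ {w} → w ∈ xs → D y w ≡ true → D w x ≡ false) → score xs D y < score xs D x
    score-drop {x} {y} x∈ y∈ Dxy no-path = ∑-mono-< pointwise y∈ strict
      where
      pointwise : ∀ {w} → w ∈ xs → ⟦ D y w ⟧ ≤ ⟦ D x w ⟧
      pointwise {w} w∈ with D y w in Dyw
      ... | false = z≤n
      ... | true = ≤-reflexive (cong ⟦_⟧ (sym Dxw))
        where
        w≢x : w ≢ x
        w≢x refl = contradiction (trans (sym Dyw) (arc⇒no-converse x∈ y∈ Dxy)) λ ()
        Dxw : D x w ≡ true
        Dxw = trans (opposite w∈ x∈ w≢x) (cong not (no-path w∈ Dyw))
      strict : ⟦ D y y ⟧ < ⟦ D x y ⟧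
      strict rewrite irreflexive y | Dxy = ≤-refl

    equal-scores⇒cyclic : ∀ {x y} → x ∈ xs → y ∈ xs → D x y ≡ true → score xs D x ≡ score xs D y →
      ∃ λ w → w ∈ xs × D y w ≡ true × D w x ≡ true
    equal-scores⇒cyclic {x} {y} x∈ y∈ Dxy same
      with any? (λ w → (D y w ≟𝔹 true) ×-dec (D w x ≟𝔹 true)) xs
    ... | yes path = let w , w∈ , Dyw , Dwx = find path in w , w∈ , Dyw , Dwx
    ... | no ¬path = contradiction (score-drop x∈ y∈ Dxy no-path) (<-irrefl (sym same))
      where
      no-path : ∀ {w} → w ∈ xs → D y w ≡ true → D w x ≡ false
      no-path {w} w∈ Dyw with D w x in Dwx
      ... | false = refl
      ... | true = contradiction (lose w∈ (Dyw , Dwx)) ¬path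

  module _ {xs D} (unique : Unique xs) (tournament : IsTournamentOn xs D) where
    open IsTournamentOn tournament

    score<length : ∀ {a} → a ∈ xs → score xs D a < length xs
    score<length {a} a∈ = subst (score xs D a <_) (sym (length≡∑1 xs))
      (∑-mono-< (λ {w} _ → ⟦⟧≤1 (D a w)) a∈ Daa<1)
      where
      Daa<1 : ⟦ D a a ⟧ < 1
      Daa<1 rewrite irreflexive a = ≤-refl

    top-exists : ∀ {m} → length xs ≡ suc m → ScoresDistinct xs D → ∃ λ t → t ∈ xs × score xs D t ≡ m
    top-exists {m} len distinct with any? (λ a → score xs D a ≟ℕ m) xs
    ... | yes top = find top
    ... | no ¬top = contradiction (pigeonhole (score xs D) unique distinct below-m) too-many
      where
      below-m : ∀ {a} → a ∈ xs → score xs D a ∈ upTo m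
      below-m a∈ = ∈-upTo⁺ (≤∧≢⇒< (≤-pred (subst (score xs D _ <_) len (score<length a∈))) (¬top ∘ lose a∈))
      too-many : ¬ (length xs ≤ length (upTo m))
      too-many le = 1+n≰n (subst₂ _≤_ len (length-upTo m) le)

    module RemoveTop {m t} (len : length xs ≡ suc m) (t∈ : t ∈ xs) (top : score xs D t ≡ m) where

      others : ∑[ w ∈ xs ] ⟦ not (does (w ≟ t)) ⟧ ≡ m
      others = suc-injective (begin
        suc others′                                   ≡⟨ cong (_+ others′) (sym (Unique⇒count≡1 unique t∈)) ⟩
        count t xs + others′                          ≡⟨ sym (∑-+ xs (λ w → δ w t) _) ⟩
        ∑[ w ∈ xs ] (δ w t + ⟦ not (does (w ≟ t)) ⟧)  ≡⟨ ∑-cong xs (λ w → ⟦b⟧+⟦not-b⟧≡1 (does (w ≟ t))) ⟩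
        ∑[ w ∈ xs ] 1                                 ≡⟨ sym (length≡∑1 xs) ⟩
        length xs                                     ≡⟨ len ⟩
        suc m                                         ∎)
        where
        open ≡-Reasoning
        others′ = ∑[ w ∈ xs ] ⟦ not (does (w ≟ t)) ⟧

      top-beats-others : ∀ {w} → w ∈ xs → w ≢ t → D t w ≡ true
      top-beats-others {w} w∈ w≢t with D t w in Dtw
      ... | true = refl
      ... | false = contradiction (∑-mono-< pointwise w∈ strict) (<-irrefl (trans top (sym others)))
        where
        pointwise : ∀ {v} → v ∈ xs → ⟦ D t v ⟧ ≤ ⟦ not (does (v ≟ t)) ⟧
        pointwise {v} _ with v ≟ t
        ... | yes refl = ≤-reflexive (cong ⟦_⟧ (irreflexive t))
        ... | no _ = ⟦⟧≤1 (D t v)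
        strict : ⟦ D t w ⟧ < ⟦ not (does (w ≟ t)) ⟧
        strict rewrite Dtw | dec-false (w ≟ t) w≢t = ≤-refl

      nothing-beats-top : ∀ {w} → w ∈ xs → D w t ≡ false
      nothing-beats-top {w} w∈ with w ≟ t
      ... | yes refl = irreflexive t
      ... | no w≢t = arc⇒no-converse t∈ w∈ (top-beats-others w∈ w≢t)

      xs∖t : List A
      xs∖t = filter (λ w → ¬? (w ≟ t)) xs

      ∈-xs∖t : ∀ {w} → w ∈ xs → w ≢ t → w ∈ xs∖t
      ∈-xs∖t w∈ w≢t = ∈-filter⁺ (λ w → ¬? (w ≟ t)) w∈ w≢t

      xs∖t-⊆ : ∀ {w} → w ∈ xs∖t → w ∈ xs
      xs∖t-⊆ = proj₁ ∘ ∈-filter⁻ (λ w → ¬? (w ≟ t))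

      length-xs∖t : length xs∖t ≡ m
      length-xs∖t = trans (length-filter (λ w → ¬? (w ≟ t)) xs) others

      tournament-xs∖t : IsTournamentOn xs∖t D
      tournament-xs∖t = record
        { irreflexive = irreflexive
        ; opposite = λ x∈ y∈ → opposite (xs∖t-⊆ x∈) (xs∖t-⊆ y∈) }

      score-xs∖t : ∀ {a} → a ∈ xs → score xs∖t D a ≡ score xs D a
      score-xs∖t {a} a∈ = trans (∑-filter (λ w → ¬? (w ≟ t)) xs (λ w → ⟦ D a w ⟧)) (∑-cong xs pointwise)
        where
        pointwise : ∀ w → (if not (does (w ≟ t)) then ⟦ D a w ⟧ else 0) ≡ ⟦ D a w ⟧
        pointwise w with w ≟ t
        ... | yes refl = cong ⟦_⟧ (sym (nothing-beats-top a∈))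
        ... | no _ = refl

      distinct-xs∖t : ScoresDistinct xs D → ScoresDistinct xs∖t D
      distinct-xs∖t distinct a∈ b∈ same = distinct (xs∖t-⊆ a∈) (xs∖t-⊆ b∈)
        (trans (sym (score-xs∖t (xs∖t-⊆ a∈))) (trans same (score-xs∖t (xs∖t-⊆ b∈))))

  -- Induct on the length: the vertex of top score beats all others, and removing it keeps scores distinct.
  distinct-scores⇒acyclic : ∀ {xs D} → Unique xs → IsTournamentOn xs D → ScoresDistinct xs D →
    ∀ {x y z} → x ∈ xs → y ∈ xs → z ∈ xs → D x y ≡ true → D y z ≡ true → D z x ≡ true → ⊥
  distinct-scores⇒acyclic = by-length _ refl
    where
    by-length : ∀ m {xs D} → length xs ≡ m → Unique xs → IsTournamentOn xs D → ScoresDistinct xs D →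
      ∀ {x y z} → x ∈ xs → y ∈ xs → z ∈ xs → D x y ≡ true → D y z ≡ true → D z x ≡ true → ⊥
    by-length zero {[]} _ _ _ _ ()
    by-length (suc m) {xs} {D} len unique tournament distinct x∈ y∈ z∈ Dxy Dyz Dzx =
      by-length m length-xs∖t (Unique.filter⁺ _ unique) tournament-xs∖t (distinct-xs∖t distinct)
        (keep x∈ Dzx z∈) (keep y∈ Dxy x∈) (keep z∈ Dyz y∈) Dxy Dyz Dzx
      where
      top = top-exists unique tournament len distinct
      open RemoveTop unique tournament len (proj₁ (proj₂ top)) (proj₂ (proj₂ top))
      keep : ∀ {v u} → v ∈ xs → D u v ≡ true → u ∈ xs → v ∈ xs∖t
      keep v∈ Duv u∈ = ∈-xs∖t v∈ λ { refl → contradiction (trans (sym Duv) (nothing-beats-top u∈)) λ () }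

isEven-2+ : ∀ k → isEven (2 + k) ≡ isEven k
isEven-2+ k = cong (_≡ᵇ 0) (trans (cong (_% 2) (+-comm 2 k)) ([m+n]%n≡m%n k 2))

isEven-suc : ∀ k → isEven (suc k) ≡ not (isEven k)
isEven-suc zero = refl
isEven-suc (suc k) =
  trans (isEven-2+ k) (trans (sym (not-involutive (isEven k))) (cong not (sym (isEven-suc k))))

isEven-+ : ∀ a b → isEven (a + b) ≡ not (isEven a xor isEven b)
isEven-+ zero b = sym (trans (cong not (true-xor (isEven b))) (not-involutive (isEven b)))
isEven-+ (suc a) b = begin
  isEven (suc (a + b))                 ≡⟨ isEven-suc (a + b) ⟩
  not (isEven (a + b))                 ≡⟨ cong not (isEven-+ a b) ⟩
  not (not (isEven a xor isEven b))    ≡⟨ cong not (not-distribˡ-xor (isEven a) (isEven b)) ⟩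
  not (not (isEven a) xor isEven b)    ≡⟨ cong (λ e → not (e xor isEven b)) (sym (isEven-suc a)) ⟩
  not (isEven (suc a) xor isEven b)    ∎
  where open ≡-Reasoning

isEven-double : ∀ k → isEven (k + k) ≡ true
isEven-double zero = refl
isEven-double (suc k) = trans (cong (isEven ∘ suc) (+-suc k k)) (trans (isEven-2+ (k + k)) (isEven-double k))

odd-sum⇒opposite-parity : ∀ a b k → a + b ≡ suc (k + k) → isEven a ≡ not (isEven b)
odd-sum⇒opposite-parity a b k a+b-odd = opposite (isEven a) (isEven b) (begin
  not (isEven a xor isEven b)  ≡⟨ sym (isEven-+ a b) ⟩
  isEven (a + b)               ≡⟨ cong isEven a+b-odd ⟩
  isEven (suc (k + k))         ≡⟨ isEven-suc (k + k) ⟩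
  not (isEven (k + k))         ≡⟨ cong not (isEven-double k) ⟩
  false                        ∎)
  where
  open ≡-Reasoning
  opposite : ∀ p q → not (p xor q) ≡ false → p ≡ not q
  opposite true false _ = refl
  opposite false true _ = refl

-- The rectangular graph

module Rectangle (r n : ℕ) where

  Vertex : Set
  Vertex = V r n

  -- _≟V_, _<ₗ?_ and adjacent? are chosen so that _==V_, _<V_ and adjacent are definitionally their does.
  _≟V_ : DecidableEquality Vertex
  _≟V_ = Fin._≟_ ≟× Fin._≟_

  open Listing _≟V_ public

  vertices : List Vertex
  vertices = allV r n

  vertices-isListing : IsListing vertices
  vertices-isListing = cartesianProduct-isListing Fin._≟_ Fin._≟_ {allFin r} {allFin n} (allFin-isListing r) (allFin-isListing n)

  ∈-vertices : ∀ x → x ∈ vertices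
  ∈-vertices = IsListing⇒∈ vertices-isListing

  ∑² : (Vertex → Vertex → ℕ) → ℕ
  ∑² F = ∑[ a ∈ vertices ] ∑[ b ∈ vertices ] F a b

  ∑²-cong : ∀ {F G : Vertex → Vertex → ℕ} → (∀ a b → F a b ≡ G a b) → ∑² F ≡ ∑² G
  ∑²-cong F≗G = ∑-cong vertices (λ a → ∑-cong vertices (F≗G a))

  ∑²-+ : ∀ (F G : Vertex → Vertex → ℕ) → ∑² (λ a b → F a b + G a b) ≡ ∑² F + ∑² G
  ∑²-+ F G = trans (∑-cong vertices (λ a → ∑-+ vertices (F a) (G a))) (∑-+ vertices _ _)

  ∑²-*ˡ : ∀ c (F : Vertex → Vertex → ℕ) → ∑² (λ a b → c * F a b) ≡ c * ∑² F
  ∑²-*ˡ c F = trans (∑-cong vertices (λ a → ∑-*ˡ vertices c (F a))) (∑-*ˡ vertices c _)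

  ∑²-transpose : ∀ (F : Vertex → Vertex → ℕ) → ∑² (λ a b → F b a) ≡ ∑² F
  ∑²-transpose F = ∑-swap vertices vertices (λ a b → F b a)

  ∑²-δˡ : ∀ x (G : Vertex → ℕ) → ∑² (λ a b → δ a x * G b) ≡ ∑ vertices G
  ∑²-δˡ x G = trans (∑-cong vertices (λ a → ∑-*ˡ vertices (δ a x) G))
    (∑-δ {vertices} vertices-isListing x (λ _ → ∑ vertices G))

  _<ₗ_ : Vertex → Vertex → Set
  _<ₗ_ = ×-Lex _≡_ _<ᶠ_ _<ᶠ_

  _<ₗ?_ : ∀ x y → Dec (x <ₗ y)
  _<ₗ?_ = ×-decidable Fin._≟_ Fin._<?_ Fin._<?_

  open IsStrictTotalOrder (×-isStrictTotalOrder (Fin.<-isStrictTotalOrder {r}) (Fin.<-isStrictTotalOrder {n}))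
    using (compare) renaming (irrefl to <ₗ-irrefl; trans to <ₗ-trans)

  <V-irrefl : ∀ x → x <V x ≡ false
  <V-irrefl x = dec-false (x <ₗ? x) (<ₗ-irrefl (refl , refl))

  <V-flip : ∀ {x y} → x ≢ y → y <V x ≡ not (x <V y)
  <V-flip {x} {y} x≢y with compare x y
  ... | tri< x<y _ y≮x = trans (dec-false (y <ₗ? x) y≮x) (cong not (sym (dec-true (x <ₗ? y) x<y)))
  ... | tri≈ _ x≈y _ = contradiction (≡×≡⇒≡ x≈y) x≢y
  ... | tri> x≮y _ y<x = trans (dec-true (y <ₗ? x) y<x) (cong not (sym (dec-false (x <ₗ? y) x≮y)))

  <V-asym : ∀ {x y} → x <V y ≡ true → y <V x ≡ false
  <V-asym {x} {y} x<y = trans (<V-flip {x} {y} λ { refl → contradiction (trans (sym x<y) (<V-irrefl x)) λ () }) (cong not x<y)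

  Adjacent : Vertex → Vertex → Set
  Adjacent x y = x ≢ y × (proj₁ x ≡ proj₁ y ⊎ proj₂ x ≡ proj₂ y)

  adjacent? : ∀ x y → Dec (Adjacent x y)
  adjacent? x y = ¬? (x ≟V y) ×-dec (proj₁ x Fin.≟ proj₁ y ⊎-dec proj₂ x Fin.≟ proj₂ y)

  adjacent-sym : ∀ x y → adjacent x y ≡ adjacent y x
  adjacent-sym x y = does-⇔ (mk⇔ flip flip) (adjacent? x y) (adjacent? y x)
    where
    flip : ∀ {x y} → Adjacent x y → Adjacent y x
    flip (x≢y , shared) = x≢y ∘ sym , ⊎-map sym sym shared

  adjacent-irrefl : ∀ x → adjacent x x ≡ false
  adjacent-irrefl x = dec-false (adjacent? x x) (λ (x≢x , _) → x≢x refl)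

  adjacent⇒≢ : ∀ {x y} → adjacent x y ≡ true → x ≢ y
  adjacent⇒≢ {x} {y} = proj₁ ∘ does-sound (adjacent? x y)

  data Line : Set where
    row : Fin r → Line
    col : Fin n → Line

  onLine : Line → Vertex → Bool
  onLine (row i) (a , _) = does (a Fin.≟ i)
  onLine (col j) (_ , b) = does (b Fin.≟ j)

  lineThrough : Vertex → Vertex → Line
  lineThrough (i , j) (i′ , _) = if does (i Fin.≟ i′) then row i else col j

  lineThrough-∋ : ∀ x y → adjacent x y ≡ true →
    onLine (lineThrough x y) x ≡ true × onLine (lineThrough x y) y ≡ true
  lineThrough-∋ (i , j) (i′ , j′) adj with i Fin.≟ i′ | does-sound (adjacent? (i , j) (i′ , j′)) adj
  ... | yes refl | _ = dec-true (i Fin.≟ i) refl , dec-true (i Fin.≟ i) refl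
  ... | no i≢i′ | _ , inj₁ i≡i′ = contradiction i≡i′ i≢i′
  ... | no _ | _ , inj₂ refl = dec-true (j Fin.≟ j) refl , dec-true (j Fin.≟ j) refl

  onLine-row : ∀ i x → onLine (row i) x ≡ true → proj₁ x ≡ i
  onLine-row i (a , _) = does-sound (a Fin.≟ i)

  onLine-col : ∀ j x → onLine (col j) x ≡ true → proj₂ x ≡ j
  onLine-col j (_ , b) = does-sound (b Fin.≟ j)

  onLine⇒adjacent : ∀ ℓ {x y} → x ≢ y → onLine ℓ x ≡ true → onLine ℓ y ≡ true → adjacent x y ≡ true
  onLine⇒adjacent (row i) {x} {y} x≢y x∈ℓ y∈ℓ =
    dec-true (adjacent? x y) (x≢y , inj₁ (trans (onLine-row i x x∈ℓ) (sym (onLine-row i y y∈ℓ))))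
  onLine⇒adjacent (col j) {x} {y} x≢y x∈ℓ y∈ℓ =
    dec-true (adjacent? x y) (x≢y , inj₂ (trans (onLine-col j x x∈ℓ) (sym (onLine-col j y y∈ℓ))))

  lines-meet-once : ∀ ℓ ℓ′ {x y} → x ≢ y →
    onLine ℓ x ≡ true → onLine ℓ y ≡ true → onLine ℓ′ x ≡ true → onLine ℓ′ y ≡ true →
    ∀ w → onLine ℓ w ≡ onLine ℓ′ w
  lines-meet-once (row i) (row i′) {x} _ x∈ℓ _ x∈ℓ′ _ w =
    cong (λ k → onLine (row k) w) (trans (sym (onLine-row i x x∈ℓ)) (onLine-row i′ x x∈ℓ′))
  lines-meet-once (col j) (col j′) {x} _ x∈ℓ _ x∈ℓ′ _ w =
    cong (λ k → onLine (col k) w) (trans (sym (onLine-col j x x∈ℓ)) (onLine-col j′ x x∈ℓ′))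
  lines-meet-once (row i) (col j) {x} {y} x≢y x∈ℓ y∈ℓ x∈ℓ′ y∈ℓ′ w = contradiction
    (≡×≡⇒≡ ( trans (onLine-row i x x∈ℓ) (sym (onLine-row i y y∈ℓ))
           , trans (onLine-col j x x∈ℓ′) (sym (onLine-col j y y∈ℓ′)))) x≢y
  lines-meet-once (col j) (row i) {x} {y} x≢y x∈ℓ y∈ℓ x∈ℓ′ y∈ℓ′ w = contradiction
    (≡×≡⇒≡ ( trans (onLine-row i x x∈ℓ′) (sym (onLine-row i y y∈ℓ′))
           , trans (onLine-col j x x∈ℓ) (sym (onLine-col j y y∈ℓ)))) x≢y

  triangle-on-line : ∀ x y z → adjacent x y ≡ true → adjacent y z ≡ true → adjacent z x ≡ true →
    onLine (lineThrough x y) z ≡ true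
  triangle-on-line (a , b) (c , d) (e , f) xy yz zx
    with a Fin.≟ c | does-sound (adjacent? _ _) xy | does-sound (adjacent? _ _) yz | does-sound (adjacent? _ _) zx
  ... | yes refl | _ | _ | _ , inj₁ e≡a = dec-true (e Fin.≟ a) e≡a
  ... | yes refl | _ | _ , inj₁ c≡e | _ = dec-true (e Fin.≟ a) (sym c≡e)
  ... | yes refl | x≢y , _ | _ , inj₂ d≡f | _ , inj₂ f≡b = contradiction (cong (a ,_) (sym (trans d≡f f≡b))) x≢y
  ... | no a≢c | _ , inj₁ a≡c | _ | _ = contradiction a≡c a≢c
  ... | no _ | _ | _ | _ , inj₂ f≡b = dec-true (f Fin.≟ b) f≡b
  ... | no a≢c | _ | _ , inj₁ c≡e | _ , inj₁ e≡a = contradiction (sym (trans c≡e e≡a)) a≢c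
  ... | no _ | _ , inj₂ b≡d | _ , inj₂ d≡f | _ = dec-true (f Fin.≟ b) (sym (trans b≡d d≡f))

  -- Orientations as arc relations

  open Orienting _≟V_ using (_≟²_; δ²; count²; orientEdge; arcsOf; arcsOf-vecMap; δ²-orientEdge; bits-recovered; ∑-tails)

  Edge : Set
  Edge = Vertex × Vertex

  isEdge : Vertex → Vertex → Bool
  isEdge a b = adjacent a b ∧ (a <V b)

  ∑²-adjacent : ∀ (F : Vertex → Vertex → ℕ) → (∀ a b → F a b ≡ F b a) →
    ∑² (λ a b → if adjacent a b then F a b else 0)
      ≡ ∑² (λ a b → if isEdge a b then F a b else 0) + ∑² (λ a b → if isEdge a b then F a b else 0)
  ∑²-adjacent F F-sym = trans (∑²-cong split) (trans (∑²-+ _ _)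
    (cong (∑² (λ a b → if isEdge a b then F a b else 0) +_) (∑²-transpose (λ a b → if isEdge a b then F a b else 0))))
    where
    split : ∀ a b → (if adjacent a b then F a b else 0) ≡ (if isEdge a b then F a b else 0) + (if isEdge b a then F b a else 0)
    split a b rewrite adjacent-sym b a with adjacent a b in adj
    ... | false = refl
    ... | true rewrite <V-flip {a} {b} (adjacent⇒≢ adj) with a <V b
    ...   | true = sym (+-identityʳ (F a b))
    ...   | false = F-sym a b

  ∑-edges : ∀ (g : Edge → ℕ) →
    ∑ (edges r n) g ≡ ∑[ a ∈ vertices ] ∑[ b ∈ vertices ] (if isEdge a b then g (a , b) else 0)
  ∑-edges g = trans (∑-concatMap vertices _ g) (∑-cong vertices λ a →
    trans (∑-map (filter (λ b → T? (isEdge a b)) vertices) (a ,_) g)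
          (∑-filter (λ b → T? (isEdge a b)) vertices (λ b → g (a , b))))

  ∑-edges-δ² : ∀ (h : Edge → ℕ) x y →
    ∑[ e ∈ edges r n ] δ² e (x , y) * h e ≡ (if isEdge x y then h (x , y) else 0)
  ∑-edges-δ² h x y = trans (∑-edges _) (trans
    (∑-cong vertices λ a → ∑-cong vertices λ b → pointwise a b (isEdge a b))
    (∑-δ² {vertices} vertices-isListing x y (λ a b → if isEdge a b then h (a , b) else 0)))
    where
    pointwise : ∀ a b c → (if c then δ² (a , b) (x , y) * h (a , b) else 0)
                          ≡ δ a x * (δ b y * (if c then h (a , b) else 0))
    pointwise a b true = trans (cong (_* h (a , b)) (δ-× _≟V_ _≟V_ a b x y)) (*-assoc (δ a x) (δ b y) _)
    pointwise a b false = sym (trans (cong (δ a x *_) (*-zeroʳ (δ b y))) (*-zeroʳ (δ a x)))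

  count-edges : ∀ x y → count² (x , y) (edges r n) ≡ ⟦ isEdge x y ⟧
  count-edges x y = trans (∑-cong (edges r n) (λ e → sym (*-identityʳ (δ² e (x , y))))) (trans
    (∑-edges-δ² (λ _ → 1) x y) (if-⟦⟧ (isEdge x y)))
    where
    if-⟦⟧ : ∀ c → (if c then 1 else 0) ≡ ⟦ c ⟧
    if-⟦⟧ true = refl
    if-⟦⟧ false = refl

  edges-unique : Unique (edges r n)
  edges-unique = Listing.count≤1⇒Unique _≟²_ (edges r n) λ (x , y) →
    subst (_≤ 1) (sym (count-edges x y)) (⟦⟧≤1 (isEdge x y))

  ∈-edges⇒isEdge : ∀ {x y} → (x , y) ∈ edges r n → isEdge x y ≡ true
  ∈-edges⇒isEdge {x} {y} e∈ with isEdge x y in isEdge≡ | Listing.∈⇒count≥1 _≟²_ e∈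
  ... | true | _ = refl
  ... | false | 1≤count rewrite count-edges x y | isEdge≡ = contradiction 1≤count λ ()

  isEdge⇒∈-edges : ∀ {x y} → isEdge x y ≡ true → (x , y) ∈ edges r n
  isEdge⇒∈-edges {x} {y} edge = Listing.count≥1⇒∈ _≟²_ (edges r n)
    (subst (1 ≤_) (sym (trans (count-edges x y) (cong ⟦_⟧ edge))) ≤-refl)

  edges-no-reversal : ∀ {e e′} → e ∈ edges r n → e′ ∈ edges r n → e′ ≢ swap e
  edges-no-reversal {a , b} e∈ e′∈ refl = contradiction
    (trans (sym (proj₂ (∧≡true (∈-edges⇒isEdge e′∈)))) (<V-asym {a} {b} (proj₂ (∧≡true (∈-edges⇒isEdge e∈)))))
    λ ()

  arcOfBits : (Edge → Bool) → Vertex → Vertex → Bool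
  arcOfBits g x y = if adjacent x y then (if x <V y then not (g (x , y)) else g (y , x)) else false

  fromBits : (Edge → Bool) → Orientation r n
  fromBits g = orient (vecMap g (edges r n))

  inversionBit : (Vertex → Vertex → Bool) → Edge → Bool
  inversionBit D (a , b) = D b a

  fromRelation : (Vertex → Vertex → Bool) → Orientation r n
  fromRelation D = fromBits (inversionBit D)

  fromRelation-cong : ∀ {D D′} → (∀ x y → D x y ≡ D′ x y) → fromRelation D ≡ fromRelation D′
  fromRelation-cong D≗D′ = cong orient (vecMap-cong (edges r n) (λ {(a , b)} _ → D≗D′ b a))

  fromRelation-arc : ∀ o → fromRelation (arc o) ≡ o
  fromRelation-arc (orient bits) = cong orient (bits-recovered (edges r n) bits edges-unique edges-no-reversal)

  arcOfBits-split : ∀ g x y →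
    (if isEdge x y then ⟦ not (g (x , y)) ⟧ else 0) + (if isEdge y x then ⟦ g (y , x) ⟧ else 0)
      ≡ ⟦ arcOfBits g x y ⟧
  arcOfBits-split g x y with adjacent x y in adj
  ... | false rewrite adjacent-sym y x | adj = refl
  ... | true rewrite adjacent-sym y x | adj | <V-flip {x} {y} (adjacent⇒≢ adj) with x <V y
  ...   | true = +-identityʳ _
  ...   | false = refl

  count-arcs-fromBits : ∀ g x y → count² (x , y) (arcs (fromBits g)) ≡ ⟦ arcOfBits g x y ⟧
  count-arcs-fromBits g x y = begin
    count² (x , y) (arcs (fromBits g))
      ≡⟨ cong (count² (x , y)) (arcsOf-vecMap (edges r n) g) ⟩
    count² (x , y) (map (λ e → orientEdge e (g e)) (edges r n))
      ≡⟨ ∑-map (edges r n) _ _ ⟩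
    ∑[ e ∈ edges r n ] δ² (orientEdge e (g e)) (x , y)
      ≡⟨ ∑-cong (edges r n) (λ e → δ²-orientEdge e (g e) (x , y)) ⟩
    ∑[ e ∈ edges r n ] (δ² e (x , y) * ⟦ not (g e) ⟧ + δ² e (y , x) * ⟦ g e ⟧)
      ≡⟨ ∑-+ (edges r n) _ _ ⟩
    (∑[ e ∈ edges r n ] δ² e (x , y) * ⟦ not (g e) ⟧) + (∑[ e ∈ edges r n ] δ² e (y , x) * ⟦ g e ⟧)
      ≡⟨ cong₂ _+_ (∑-edges-δ² (λ e → ⟦ not (g e) ⟧) x y) (∑-edges-δ² (λ e → ⟦ g e ⟧) y x) ⟩
    (if isEdge x y then ⟦ not (g (x , y)) ⟧ else 0) + (if isEdge y x then ⟦ g (y , x) ⟧ else 0)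
      ≡⟨ arcOfBits-split g x y ⟩
    ⟦ arcOfBits g x y ⟧ ∎
    where open ≡-Reasoning

  arc-fromBits : ∀ g x y → arc (fromBits g) x y ≡ arcOfBits g x y
  arc-fromBits g x y = any-from-count (arcs (fromBits g)) _ _ (count-arcs-fromBits g x y)

  arc≡arcOfBits : ∀ o x y → arc o x y ≡ arcOfBits (inversionBit (arc o)) x y
  arc≡arcOfBits o x y =
    trans (cong (λ o′ → arc o′ x y) (sym (fromRelation-arc o))) (arc-fromBits (inversionBit (arc o)) x y)

  count-arcs : ∀ o x y → count² (x , y) (arcs o) ≡ ⟦ arc o x y ⟧
  count-arcs o x y = begin
    count² (x , y) (arcs o)                   ≡⟨ cong (λ o′ → count² (x , y) (arcs o′)) (sym (fromRelation-arc o)) ⟩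
    count² (x , y) (arcs (fromRelation (arc o))) ≡⟨ count-arcs-fromBits (inversionBit (arc o)) x y ⟩
    ⟦ arcOfBits (inversionBit (arc o)) x y ⟧   ≡⟨ cong ⟦_⟧ (sym (arc≡arcOfBits o x y)) ⟩
    ⟦ arc o x y ⟧                             ∎
    where open ≡-Reasoning

  outdeg≡∑-arc : ∀ o v → outdeg o v ≡ ∑[ w ∈ vertices ] ⟦ arc o v w ⟧
  outdeg≡∑-arc o v = begin
    outdeg o v                                    ≡⟨ length-filter (λ a → T? (proj₁ a ==V v)) (arcs o) ⟩
    ∑[ a ∈ arcs o ] δ (proj₁ a) v                 ≡⟨ ∑-tails {vertices} vertices-isListing (arcs o) v ⟩
    ∑[ w ∈ vertices ] count² (v , w) (arcs o)     ≡⟨ ∑-cong vertices (count-arcs o v) ⟩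
    ∑[ w ∈ vertices ] ⟦ arc o v w ⟧               ∎
    where open ≡-Reasoning

  inversionsOf : (Vertex → Vertex → Bool) → ℕ
  inversionsOf D = ∑² (λ a b → if isEdge a b then ⟦ D b a ⟧ else 0)

  inversions≡inversionsOf : ∀ o → inversions o ≡ inversionsOf (arc o)
  inversions≡inversionsOf o = begin
    inversions o                              ≡⟨ cong inversions (sym (fromRelation-arc o)) ⟩
    inversions (fromRelation (arc o))         ≡⟨ length-filter T? (toList (vecMap bit (edges r n))) ⟩
    ∑ (toList (vecMap bit (edges r n))) ⟦_⟧   ≡⟨ cong (λ bs → ∑ bs ⟦_⟧) (toList-vecMap bit (edges r n)) ⟩
    ∑ (map bit (edges r n)) ⟦_⟧               ≡⟨ ∑-map (edges r n) bit ⟦_⟧ ⟩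
    ∑[ e ∈ edges r n ] ⟦ bit e ⟧              ≡⟨ ∑-edges (λ e → ⟦ bit e ⟧) ⟩
    inversionsOf (arc o)                      ∎
    where
    open ≡-Reasoning
    bit = inversionBit (arc o)

  lineVertices : Line → List Vertex
  lineVertices ℓ = filter (λ w → T? (onLine ℓ w)) vertices

  ∈-lineVertices : ∀ ℓ {w} → onLine ℓ w ≡ true → w ∈ lineVertices ℓ
  ∈-lineVertices ℓ {w} w∈ℓ = ∈-filter⁺ (λ w → T? (onLine ℓ w)) (∈-vertices w) (Equivalence.from T-≡ w∈ℓ)

  lineVertices⇒onLine : ∀ ℓ {w} → w ∈ lineVertices ℓ → onLine ℓ w ≡ true
  lineVertices⇒onLine ℓ = Equivalence.to T-≡ ∘ proj₂ ∘ ∈-filter⁻ (λ w → T? (onLine ℓ w)) {xs = vertices}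

  lineVertices-unique : ∀ ℓ → Unique (lineVertices ℓ)
  lineVertices-unique ℓ = Unique.filter⁺ _ (IsListing⇒Unique {vertices} vertices-isListing)

  open Tournament _≟V_ using (score; IsTournamentOn; ScoresDistinct; equal-scores⇒cyclic; distinct-scores⇒acyclic)

  lineScore : (Vertex → Vertex → Bool) → Line → Vertex → ℕ
  lineScore D ℓ = score (lineVertices ℓ) D

  lineScore≡∑ : ∀ D ℓ x → lineScore D ℓ x ≡ ∑[ w ∈ vertices ] (if onLine ℓ w then ⟦ D x w ⟧ else 0)
  lineScore≡∑ D ℓ x = ∑-filter (λ w → T? (onLine ℓ w)) vertices (λ w → ⟦ D x w ⟧)

  lineScore-cong : ∀ D ℓ ℓ′ → (∀ w → onLine ℓ w ≡ onLine ℓ′ w) →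
    ∀ x → lineScore D ℓ x ≡ lineScore D ℓ′ x
  lineScore-cong D ℓ ℓ′ ℓ≐ℓ′ x = cong (λ ws → score ws D x) (filter-≐ _ _
    ((λ {w} → subst T (ℓ≐ℓ′ w)) , (λ {w} → subst T (sym (ℓ≐ℓ′ w)))) vertices)

  record IsOrientation (D : Vertex → Vertex → Bool) : Set where
    field
      non-adjacent : ∀ x y → adjacent x y ≡ false → D x y ≡ false
      opposite     : ∀ x y → adjacent x y ≡ true → D y x ≡ not (D x y)

    irreflexive : ∀ x → D x x ≡ false
    irreflexive x = non-adjacent x x (adjacent-irrefl x)

    arc⇒adjacent : ∀ {x y} → D x y ≡ true → adjacent x y ≡ true
    arc⇒adjacent {x} {y} Dxy with adjacent x y in adj
    ... | true = refl
    ... | false = contradiction (trans (sym Dxy) (non-adjacent x y adj)) λ ()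

    onLine-tournament : ∀ ℓ → IsTournamentOn (lineVertices ℓ) D
    onLine-tournament ℓ = record
      { irreflexive = irreflexive
      ; opposite = λ {x} {y} x∈ y∈ x≢y →
          opposite x y (onLine⇒adjacent ℓ x≢y (lineVertices⇒onLine ℓ x∈) (lineVertices⇒onLine ℓ y∈)) }

  arcOfBits-isOrientation : ∀ g → IsOrientation (arcOfBits g)
  arcOfBits-isOrientation g = record { non-adjacent = non-adjacent ; opposite = opposite }
    where
    non-adjacent : ∀ x y → adjacent x y ≡ false → arcOfBits g x y ≡ false
    non-adjacent x y adj rewrite adj = refl
    opposite : ∀ x y → adjacent x y ≡ true → arcOfBits g y x ≡ not (arcOfBits g x y)
    opposite x y adj rewrite adj | adjacent-sym y x | adj | <V-flip {x} {y} (adjacent⇒≢ adj) with x <V y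
    ... | true = sym (not-involutive _)
    ... | false = refl

  arc-isOrientation : ∀ o → IsOrientation (arc o)
  arc-isOrientation o = record
    { non-adjacent = λ x y adj → trans (arc≡arcOfBits o x y) (non-adjacent x y adj)
    ; opposite = λ x y adj → trans (arc≡arcOfBits o y x)
        (trans (opposite x y adj) (cong not (sym (arc≡arcOfBits o x y)))) }
    where open IsOrientation (arcOfBits-isOrientation (inversionBit (arc o)))

  arcOfBits-inversionBit : ∀ {D} → IsOrientation D → ∀ x y → arcOfBits (inversionBit D) x y ≡ D x y
  arcOfBits-inversionBit {D} D-orientation x y with adjacent x y in adj
  ... | false = sym (non-adjacent x y adj)
    where open IsOrientation D-orientation
  ... | true with x <V y
  ...   | true = sym (opposite y x (trans (adjacent-sym y x) adj))
    where open IsOrientation D-orientation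
  ...   | false = refl

  arc-fromRelation : ∀ {D} → IsOrientation D → ∀ x y → arc (fromRelation D) x y ≡ D x y
  arc-fromRelation {D} D-orientation x y =
    trans (arc-fromBits (inversionBit D) x y) (arcOfBits-inversionBit D-orientation x y)

  hasCyclicTriangleIn : (Vertex → Vertex → Bool) → Bool
  hasCyclicTriangleIn D = any (λ x → any (λ y → any (λ z → D x y ∧ D y z ∧ D z x) vertices) vertices) vertices

  balanced : (Vertex → Vertex → Bool) → Edge → Bool
  balanced D (a , b) = lineScore D (lineThrough a b) a ≡ᵇ lineScore D (lineThrough a b) b

  balanced⇒equal-scores : ∀ D {x y} → balanced D (x , y) ≡ true →
    lineScore D (lineThrough x y) x ≡ lineScore D (lineThrough x y) y
  balanced⇒equal-scores D {x} {y} bal = ≡ᵇ⇒≡ (lineScore D (lineThrough x y) x) _ (Equivalence.from T-≡ bal)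

  firstBalancedEdge : (Vertex → Vertex → Bool) → Maybe Edge
  firstBalancedEdge D = findᵇ (balanced D) (edges r n)

  cyclic⇒hasCyclicTriangleIn : ∀ {D x y z} → D x y ≡ true → D y z ≡ true → D z x ≡ true →
    hasCyclicTriangleIn D ≡ true
  cyclic⇒hasCyclicTriangleIn {D} {x} {y} {z} Dxy Dyz Dzx =
    any-true _ (∈-vertices x) (any-true _ (∈-vertices y) (any-true _ (∈-vertices z)
      (cong₂ _∧_ Dxy (cong₂ _∧_ Dyz Dzx))))

  module _ {D} (D-orientation : IsOrientation D) where
    open IsOrientation D-orientation

    cyclic-on-line : ∀ ℓ {x y} → onLine ℓ x ≡ true → onLine ℓ y ≡ true → D x y ≡ true →
      lineScore D ℓ x ≡ lineScore D ℓ y → hasCyclicTriangleIn D ≡ true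
    cyclic-on-line ℓ {x} {y} x∈ y∈ Dxy same
      with equal-scores⇒cyclic (onLine-tournament ℓ) (∈-lineVertices ℓ x∈) (∈-lineVertices ℓ y∈) Dxy same
    ... | w , _ , Dyw , Dwx = cyclic⇒hasCyclicTriangleIn {D} {x} {y} {w} Dxy Dyw Dwx

    balanced⇒cyclic : ∀ {x y} → adjacent x y ≡ true → balanced D (x , y) ≡ true → hasCyclicTriangleIn D ≡ true
    balanced⇒cyclic {x} {y} adj bal with D x y in Dxy | lineThrough-∋ x y adj
    ... | true | x∈ , y∈ = cyclic-on-line (lineThrough x y) x∈ y∈ Dxy (balanced⇒equal-scores D bal)
    ... | false | x∈ , y∈ = cyclic-on-line (lineThrough x y) y∈ x∈ (trans (opposite x y adj) (cong not Dxy))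
                               (sym (balanced⇒equal-scores D bal))

    module _ (none-balanced : firstBalancedEdge D ≡ nothing) where

      no-balanced-pair : ∀ ℓ {p q} → p ≢ q → onLine ℓ p ≡ true → onLine ℓ q ≡ true → p <V q ≡ true →
        lineScore D ℓ p ≡ lineScore D ℓ q → ⊥
      no-balanced-pair ℓ {p} {q} p≢q p∈ q∈ p<q same =
        contradiction (trans (sym balanced-pq) (findᵇ-nothing (edges r n) none-balanced pq-edge)) λ ()
        where
        adj = onLine⇒adjacent ℓ p≢q p∈ q∈
        pq-edge = isEdge⇒∈-edges (cong₂ _∧_ adj p<q)
        ℓ′ = lineThrough p q
        ℓ′≐ℓ = lines-meet-once ℓ′ ℓ p≢q (proj₁ (lineThrough-∋ p q adj)) (proj₂ (lineThrough-∋ p q adj)) p∈ q∈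
        balanced-pq : balanced D (p , q) ≡ true
        balanced-pq = Equivalence.to T-≡ (≡⇒≡ᵇ _ _
          (trans (lineScore-cong D ℓ′ ℓ ℓ′≐ℓ p) (trans same (sym (lineScore-cong D ℓ′ ℓ ℓ′≐ℓ q)))))

      line-scores-distinct : ∀ ℓ → ScoresDistinct (lineVertices ℓ) D
      line-scores-distinct ℓ {a} {b} a∈ b∈ same with a ≟V b | a <V b in a<b
      ... | yes a≡b | _ = a≡b
      ... | no a≢b | true =
        ⊥-elim (no-balanced-pair ℓ a≢b (lineVertices⇒onLine ℓ a∈) (lineVertices⇒onLine ℓ b∈) a<b same)
      ... | no a≢b | false =
        ⊥-elim (no-balanced-pair ℓ (a≢b ∘ sym) (lineVertices⇒onLine ℓ b∈) (lineVertices⇒onLine ℓ a∈)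
                                 (trans (<V-flip {a} {b} a≢b) (cong not a<b)) (sym same))

      no-cyclic-triangle : ∀ {x y z} → D x y ≡ true → D y z ≡ true → D z x ≡ true → ⊥
      no-cyclic-triangle {x} {y} {z} Dxy Dyz Dzx =
        distinct-scores⇒acyclic (lineVertices-unique ℓ) (onLine-tournament ℓ) (line-scores-distinct ℓ)
          (∈-lineVertices ℓ x∈) (∈-lineVertices ℓ y∈) (∈-lineVertices ℓ z∈) Dxy Dyz Dzx
        where
        ℓ = lineThrough x y
        x∈ = proj₁ (lineThrough-∋ x y (arc⇒adjacent Dxy))
        y∈ = proj₂ (lineThrough-∋ x y (arc⇒adjacent Dxy))
        z∈ = triangle-on-line x y z (arc⇒adjacent Dxy) (arc⇒adjacent Dyz) (arc⇒adjacent Dzx)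

      no-balanced-edge⇒acyclic : hasCyclicTriangleIn D ≡ false
      no-balanced-edge⇒acyclic with hasCyclicTriangleIn D in cyclic
      ... | false = refl
      ... | true with any-witness vertices _ cyclic
      ... | x , _ , ∃yz with any-witness vertices _ ∃yz
      ... | y , _ , ∃z with any-witness vertices _ ∃z
      ... | z , _ , xyz with ∧≡true xyz
      ... | Dxy , Dyz∧Dzx = ⊥-elim (no-cyclic-triangle Dxy (proj₁ (∧≡true Dyz∧Dzx)) (proj₂ (∧≡true Dyz∧Dzx)))

  -- Twisting a line

  transposition : Vertex → Vertex → Vertex → Vertex
  transposition u v x = if does (x ≟V u) then v else if does (x ≟V v) then u else x

  twist : Vertex → Vertex → (Vertex → Vertex → Bool) → Vertex → Vertex → Bool
  twist u v D x y =
    if onLine (lineThrough u v) x ∧ onLine (lineThrough u v) y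
    then D (transposition u v x) (transposition u v y)
    else D x y

  module Twisting (u v : Vertex) (uv-adjacent : adjacent u v ≡ true) where

    L : Line
    L = lineThrough u v

    σ : Vertex → Vertex
    σ = transposition u v

    u∈L : onLine L u ≡ true
    u∈L = proj₁ (lineThrough-∋ u v uv-adjacent)

    v∈L : onLine L v ≡ true
    v∈L = proj₂ (lineThrough-∋ u v uv-adjacent)

    u≢v : u ≢ v
    u≢v = adjacent⇒≢ uv-adjacent

    data Position (x : Vertex) : Set where
      at-u : x ≡ u → Position x
      at-v : x ≡ v → Position x
      elsewhere : x ≢ u → x ≢ v → Position x

    position : ∀ x → Position x
    position x with x ≟V u | x ≟V v
    ... | yes x≡u | _ = at-u x≡u
    ... | no _ | yes x≡v = at-v x≡v
    ... | no x≢u | no x≢v = elsewhere x≢u x≢v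

    σ-u : σ u ≡ v
    σ-u rewrite dec-true (u ≟V u) refl = refl

    σ-v : σ v ≡ u
    σ-v rewrite dec-false (v ≟V u) (u≢v ∘ sym) | dec-true (v ≟V v) refl = refl

    σ-elsewhere : ∀ {x} → x ≢ u → x ≢ v → σ x ≡ x
    σ-elsewhere {x} x≢u x≢v rewrite dec-false (x ≟V u) x≢u | dec-false (x ≟V v) x≢v = refl

    σ-involutive : ∀ x → σ (σ x) ≡ x
    σ-involutive x with position x
    ... | at-u refl = trans (cong σ σ-u) σ-v
    ... | at-v refl = trans (cong σ σ-v) σ-u
    ... | elsewhere x≢u x≢v = trans (cong σ (σ-elsewhere x≢u x≢v)) (σ-elsewhere x≢u x≢v)

    σ-injective : ∀ {x y} → σ x ≡ σ y → x ≡ y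
    σ-injective {x} {y} σx≡σy = trans (sym (σ-involutive x)) (trans (cong σ σx≡σy) (σ-involutive y))

    onLine-σ : ∀ x → onLine L (σ x) ≡ onLine L x
    onLine-σ x with position x
    ... | at-u refl = trans (cong (onLine L) σ-u) (trans v∈L (sym u∈L))
    ... | at-v refl = trans (cong (onLine L) σ-v) (trans u∈L (sym v∈L))
    ... | elsewhere x≢u x≢v = cong (onLine L) (σ-elsewhere x≢u x≢v)

    adjacent-σ : ∀ a b → onLine L a ≡ true → onLine L b ≡ true → adjacent (σ a) (σ b) ≡ adjacent a b
    adjacent-σ a b a∈ b∈ with a ≟V b
    ... | yes refl = trans (adjacent-irrefl (σ a)) (sym (adjacent-irrefl a))
    ... | no a≢b = trans
      (onLine⇒adjacent L (a≢b ∘ σ-injective) (trans (onLine-σ a) a∈) (trans (onLine-σ b) b∈))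
      (sym (onLine⇒adjacent L a≢b a∈ b∈))

    twist-on-L : ∀ D x y → onLine L x ≡ true → onLine L y ≡ true → twist u v D x y ≡ D (σ x) (σ y)
    twist-on-L D x y x∈ y∈ rewrite x∈ | y∈ = refl

    twist-offˡ : ∀ D x y → onLine L x ≡ false → twist u v D x y ≡ D x y
    twist-offˡ D x y x∉ rewrite x∉ = refl

    twist-offʳ : ∀ D x y → onLine L y ≡ false → twist u v D x y ≡ D x y
    twist-offʳ D x y y∉ rewrite y∉ | ∧-zeroʳ (onLine L x) = refl

    -- Case analysis through these views, since with-abstracting onLine L x would also rewrite
    -- inside the unfolded twist in the goal.
    data Side (x : Vertex) : Set where
      on-L  : onLine L x ≡ true → Side x
      off-L : onLine L x ≡ false → Side x

    side : ∀ x → Side x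
    side x with onLine L x in x∈
    ... | true = on-L x∈
    ... | false = off-L x∈

    data PairSide (x y : Vertex) : Set where
      both-on    : onLine L x ≡ true → onLine L y ≡ true → PairSide x y
      first-off  : onLine L x ≡ false → PairSide x y
      second-off : onLine L y ≡ false → PairSide x y

    pairSide : ∀ x y → PairSide x y
    pairSide x y with onLine L x in x∈ | onLine L y in y∈
    ... | true | true = both-on x∈ y∈
    ... | true | false = second-off y∈
    ... | false | _ = first-off x∈

    twist-involutive : ∀ D x y → twist u v (twist u v D) x y ≡ D x y
    twist-involutive D x y with pairSide x y
    ... | both-on x∈ y∈ = trans (twist-on-L (twist u v D) x y x∈ y∈) (trans
      (twist-on-L D (σ x) (σ y) (trans (onLine-σ x) x∈) (trans (onLine-σ y) y∈))
      (cong₂ D (σ-involutive x) (σ-involutive y)))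
    ... | first-off x∉ = trans (twist-offˡ (twist u v D) x y x∉) (twist-offˡ D x y x∉)
    ... | second-off y∉ = trans (twist-offʳ (twist u v D) x y y∉) (twist-offʳ D x y y∉)

    twist-cong : ∀ {D D′} → (∀ x y → D x y ≡ D′ x y) → ∀ x y → twist u v D x y ≡ twist u v D′ x y
    twist-cong D≗D′ x y = cong₂ (if_then_else_ (onLine L x ∧ onLine L y)) (D≗D′ (σ x) (σ y)) (D≗D′ x y)

    twist-isOrientation : ∀ {D} → IsOrientation D → IsOrientation (twist u v D)
    twist-isOrientation {D} D-orientation = record { non-adjacent = non-adjacent′ ; opposite = opposite′ }
      where
      open IsOrientation D-orientation
      non-adjacent′ : ∀ x y → adjacent x y ≡ false → twist u v D x y ≡ false
      non-adjacent′ x y adj with pairSide x y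
      ... | both-on x∈ y∈ = trans (twist-on-L D x y x∈ y∈) (non-adjacent (σ x) (σ y) (trans (adjacent-σ x y x∈ y∈) adj))
      ... | first-off x∉ = trans (twist-offˡ D x y x∉) (non-adjacent x y adj)
      ... | second-off y∉ = trans (twist-offʳ D x y y∉) (non-adjacent x y adj)
      opposite′ : ∀ x y → adjacent x y ≡ true → twist u v D y x ≡ not (twist u v D x y)
      opposite′ x y adj with pairSide x y
      ... | both-on x∈ y∈ = trans (twist-on-L D y x y∈ x∈) (trans
        (opposite (σ x) (σ y) (trans (adjacent-σ x y x∈ y∈) adj)) (cong not (sym (twist-on-L D x y x∈ y∈))))
      ... | first-off x∉ = trans (twist-offʳ D y x x∉) (trans (opposite x y adj) (cong not (sym (twist-offˡ D x y x∉))))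
      ... | second-off y∉ = trans (twist-offˡ D y x y∉) (trans (opposite x y adj) (cong not (sym (twist-offʳ D x y y∉))))

    module _ {D} (D-orientation : IsOrientation D) where
      open IsOrientation D-orientation

      D′ : Vertex → Vertex → Bool
      D′ = twist u v D

      open IsOrientation (twist-isOrientation D-orientation) using ()
        renaming (non-adjacent to non-adjacent′; opposite to opposite′; irreflexive to irreflexive′)

      changed : Vertex → Vertex → Bool
      changed a b = D′ b a xor D b a

      changed-non-adjacent : ∀ a b → adjacent a b ≡ false → changed a b ≡ false
      changed-non-adjacent a b adj = cong₂ _xor_ (non-adjacent′ b a adj′) (non-adjacent b a adj′)
        where adj′ = trans (adjacent-sym b a) adj

      changed-sym : ∀ a b → changed a b ≡ changed b a
      changed-sym a b with adjacent a b in adj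
      ... | true = sym (trans (cong₂ _xor_ (opposite′ b a adj′) (opposite b a adj′)) (xor-annihilates-not (D′ b a) (D b a)))
        where adj′ = trans (adjacent-sym b a) adj
      ... | false = trans (changed-non-adjacent a b adj) (sym (changed-non-adjacent b a (trans (adjacent-sym b a) adj)))

      changed-only-adjacent : ∀ a b → (if adjacent a b then ⟦ changed a b ⟧ else 0) ≡ ⟦ changed a b ⟧
      changed-only-adjacent a b with adjacent a b in adj
      ... | true = refl
      ... | false = cong ⟦_⟧ (sym (changed-non-adjacent a b adj))

      changed-u-v : changed u v ≡ true
      changed-u-v = begin
        D′ v u xor D v u
          ≡⟨ cong₂ _xor_ (trans (twist-on-L D v u v∈L u∈L) (cong₂ D σ-v σ-u)) (opposite u v uv-adjacent) ⟩
        D u v xor not (D u v)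
          ≡⟨ xor-inverseʳ (D u v) ⟩
        true ∎
        where open ≡-Reasoning

      changed-diagonal : ∀ a → changed a a ≡ false
      changed-diagonal a = cong₂ _xor_ (irreflexive′ a) (irreflexive a)

      distinguishes : Vertex → Bool
      distinguishes w = onLine L w ∧ not (does (w ≟V u)) ∧ not (does (w ≟V v)) ∧ (D w u xor D w v)

      distinguishes-u : distinguishes u ≡ false
      distinguishes-u rewrite dec-true (u ≟V u) refl = ∧-zeroʳ (onLine L u)

      distinguishes-v : distinguishes v ≡ false
      distinguishes-v rewrite dec-false (v ≟V u) (u≢v ∘ sym) | dec-true (v ≟V v) refl = ∧-zeroʳ (onLine L v)

      module _ {w} (w≢u : w ≢ u) (w≢v : w ≢ v) where

        distinguishes-on : onLine L w ≡ true → distinguishes w ≡ (D w u xor D w v)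
        distinguishes-on w∈ rewrite w∈ | dec-false (w ≟V u) w≢u | dec-false (w ≟V v) w≢v = refl

        distinguishes-off : onLine L w ≡ false → distinguishes w ≡ false
        distinguishes-off w∉ rewrite w∉ = refl

        changed-u-elsewhere : changed u w ≡ distinguishes w
        changed-u-elsewhere with side w
        ... | on-L w∈ = trans
          (cong (_xor D w u) (trans (twist-on-L D w u w∈ u∈L) (cong₂ D (σ-elsewhere w≢u w≢v) σ-u)))
          (trans (xor-comm (D w v) (D w u)) (sym (distinguishes-on w∈)))
        ... | off-L w∉ = trans (cong (_xor D w u) (twist-offˡ D w u w∉))
          (trans (xor-same (D w u)) (sym (distinguishes-off w∉)))

        changed-v-elsewhere : changed v w ≡ distinguishes w
        changed-v-elsewhere with side w
        ... | on-L w∈ = trans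
          (cong (_xor D w v) (trans (twist-on-L D w v w∈ v∈L) (cong₂ D (σ-elsewhere w≢u w≢v) σ-v)))
          (sym (distinguishes-on w∈))
        ... | off-L w∉ = trans (cong (_xor D w v) (twist-offˡ D w v w∉))
          (trans (xor-same (D w v)) (sym (distinguishes-off w∉)))

      changed-elsewhere : ∀ {a b} → a ≢ u → a ≢ v → b ≢ u → b ≢ v → changed a b ≡ false
      changed-elsewhere {a} {b} a≢u a≢v b≢u b≢v = trans (cong (_xor D b a) D′ba≡Dba) (xor-same (D b a))
        where
        D′ba≡Dba : D′ b a ≡ D b a
        D′ba≡Dba with pairSide b a
        ... | both-on b∈ a∈ = trans (twist-on-L D b a b∈ a∈) (cong₂ D (σ-elsewhere b≢u b≢v) (σ-elsewhere a≢u a≢v))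
        ... | first-off b∉ = twist-offˡ D b a b∉
        ... | second-off a∉ = twist-offʳ D b a a∉

      -- The changed pairs are uv and vu, and uw, wu, vw, wv for each w distinguishing u and v.
      changed-count : ∀ a b → (if adjacent a b then ⟦ changed a b ⟧ else 0) ≡
        δ a u * (δ b v + ⟦ distinguishes b ⟧)
          + (δ a v * (δ b u + ⟦ distinguishes b ⟧) + ⟦ distinguishes a ⟧ * (δ b u + δ b v))
      changed-count a b = trans (changed-only-adjacent a b) (by-position (position a) (position b))
        where
        δuv = δ-≢ u≢v
        δvu = δ-≢ (u≢v ∘ sym)
        by-position : Position a → Position b → ⟦ changed a b ⟧ ≡
          δ a u * (δ b v + ⟦ distinguishes b ⟧)
            + (δ a v * (δ b u + ⟦ distinguishes b ⟧) + ⟦ distinguishes a ⟧ * (δ b u + δ b v))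
        by-position (at-u refl) (at-u refl)
          rewrite changed-diagonal u | δ-refl u | δuv | distinguishes-u = refl
        by-position (at-u refl) (at-v refl)
          rewrite changed-u-v | δ-refl u | δ-refl v | δuv | δvu | distinguishes-u | distinguishes-v = refl
        by-position (at-u refl) (elsewhere b≢u b≢v)
          rewrite changed-u-elsewhere b≢u b≢v | δ-refl u | δuv
                | δ-≢ b≢u | δ-≢ b≢v | distinguishes-u with distinguishes b
        ... | true = refl
        ... | false = refl
        by-position (at-v refl) (at-u refl)
          rewrite changed-sym v u | changed-u-v | δ-refl u | δ-refl v
                | δuv | δvu | distinguishes-u | distinguishes-v = refl
        by-position (at-v refl) (at-v refl)
          rewrite changed-diagonal v | δ-refl v | δvu | distinguishes-v = refl
        by-position (at-v refl) (elsewhere b≢u b≢v)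
          rewrite changed-v-elsewhere b≢u b≢v | δ-refl v | δvu
                | δ-≢ b≢u | δ-≢ b≢v | distinguishes-v with distinguishes b
        ... | true = refl
        ... | false = refl
        by-position (elsewhere a≢u a≢v) (at-u refl)
          rewrite changed-sym a u | changed-u-elsewhere a≢u a≢v | δ-refl u
                | δuv | δ-≢ a≢u | δ-≢ a≢v with distinguishes a
        ... | true = refl
        ... | false = refl
        by-position (elsewhere a≢u a≢v) (at-v refl)
          rewrite changed-sym a v | changed-v-elsewhere a≢u a≢v | δ-refl v
                | δvu | δ-≢ a≢u | δ-≢ a≢v with distinguishes a
        ... | true = refl
        ... | false = refl
        by-position (elsewhere a≢u a≢v) (elsewhere b≢u b≢v)
          rewrite changed-elsewhere a≢u a≢v b≢u b≢v | δ-≢ a≢u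
                | δ-≢ a≢v | δ-≢ b≢u | δ-≢ b≢v with distinguishes a
        ... | true = refl
        ... | false = refl

      distinguishing : ℕ
      distinguishing = ∑[ w ∈ vertices ] ⟦ distinguishes w ⟧

      changes-at-adjacent-pairs : ∑² (λ a b → if adjacent a b then ⟦ changed a b ⟧ else 0)
        ≡ (1 + distinguishing) + ((1 + distinguishing) + (distinguishing + distinguishing))
      changes-at-adjacent-pairs = begin
        ∑² (λ a b → if adjacent a b then ⟦ changed a b ⟧ else 0)
          ≡⟨ ∑²-cong changed-count ⟩
        ∑² (λ a b → X a b + (Y a b + Z a b))
          ≡⟨ trans (∑²-+ X (λ a b → Y a b + Z a b)) (cong (∑² X +_) (∑²-+ Y Z)) ⟩
        ∑² X + (∑² Y + ∑² Z)
          ≡⟨ cong₂ _+_ (trans (∑²-δˡ u _) (one-plus v)) (cong₂ _+_ (trans (∑²-δˡ v _) (one-plus u)) twice) ⟩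
        (1 + distinguishing) + ((1 + distinguishing) + (distinguishing + distinguishing)) ∎
        where
        open ≡-Reasoning
        X Y Z : Vertex → Vertex → ℕ
        X a b = δ a u * (δ b v + ⟦ distinguishes b ⟧)
        Y a b = δ a v * (δ b u + ⟦ distinguishes b ⟧)
        Z a b = ⟦ distinguishes a ⟧ * (δ b u + δ b v)
        one-plus : ∀ x → ∑[ b ∈ vertices ] (δ b x + ⟦ distinguishes b ⟧) ≡ 1 + distinguishing
        one-plus x = trans (∑-+ vertices _ _) (cong (_+ distinguishing) (vertices-isListing x))
        twice : ∑² Z ≡ distinguishing + distinguishing
        twice = trans (∑-cong vertices λ a → trans (∑-*ˡ vertices ⟦ distinguishes a ⟧ _)
                        (trans (cong (⟦ distinguishes a ⟧ *_) (trans (∑-+ vertices _ _)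
                          (cong₂ _+_ (vertices-isListing u) (vertices-isListing v))))
                          (trans (*-comm ⟦ distinguishes a ⟧ 2) (cong (⟦ distinguishes a ⟧ +_) (+-identityʳ _)))))
                      (∑-+ vertices _ _)

      changed-edges : ∑² (λ a b → if isEdge a b then ⟦ changed a b ⟧ else 0) ≡ 1 + (distinguishing + distinguishing)
      changed-edges = +-double-injective _ _ (begin
        _ ≡⟨ sym (∑²-adjacent (λ a b → ⟦ changed a b ⟧) (λ a b → cong ⟦_⟧ (changed-sym a b))) ⟩
        ∑² (λ a b → if adjacent a b then ⟦ changed a b ⟧ else 0) ≡⟨ changes-at-adjacent-pairs ⟩
        (1 + c) + ((1 + c) + (c + c)) ≡⟨ regroup c ⟩
        (1 + (c + c)) + (1 + (c + c)) ∎)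
        where
        open ≡-Reasoning
        c = distinguishing
        regroup = +-*-Solver.solve 1 (λ c → (con 1 :+ c) :+ ((con 1 :+ c) :+ (c :+ c))
                                          := (con 1 :+ (c :+ c)) :+ (con 1 :+ (c :+ c))) refl
          where open +-*-Solver

      -- inversionsOf D′ + inversionsOf D counts edges inverted in both twice and changed edges once.
      twist-flips-parity : ∃ λ k → inversionsOf D′ + inversionsOf D ≡ suc (k + k)
      twist-flips-parity = both + distinguishing , (begin
        inversionsOf D′ + inversionsOf D
          ≡⟨ sym (∑²-+ _ _) ⟩
        ∑² (λ a b → (if isEdge a b then ⟦ D′ b a ⟧ else 0) + (if isEdge a b then ⟦ D b a ⟧ else 0))
          ≡⟨ ∑²-cong (λ a b → ⟦⟧-pair (isEdge a b) (D′ b a) (D b a)) ⟩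
        ∑² (λ a b → 2 * (if isEdge a b then ⟦ D′ b a ∧ D b a ⟧ else 0) + (if isEdge a b then ⟦ changed a b ⟧ else 0))
          ≡⟨ trans (∑²-+ _ _) (cong₂ _+_ (∑²-*ˡ 2 _) changed-edges) ⟩
        2 * both + (1 + (distinguishing + distinguishing))
          ≡⟨ regroup both distinguishing ⟩
        suc ((both + distinguishing) + (both + distinguishing)) ∎)
        where
        open ≡-Reasoning
        both = ∑² (λ a b → if isEdge a b then ⟦ D′ b a ∧ D b a ⟧ else 0)
        regroup = +-*-Solver.solve 2 (λ b c → (con 2 :* b) :+ (con 1 :+ (c :+ c))
                                          := con 1 :+ ((b :+ c) :+ (b :+ c))) refl
          where open +-*-Solver

      module _ (balanced-uv : balanced D (u , v) ≡ true) where

        lineScore-σ : ∀ x → lineScore D L (σ x) ≡ lineScore D L x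
        lineScore-σ x with position x
        ... | at-u refl = trans (cong (lineScore D L) σ-u) (sym (balanced⇒equal-scores D balanced-uv))
        ... | at-v refl = trans (cong (lineScore D L) σ-v) (balanced⇒equal-scores D balanced-uv)
        ... | elsewhere x≢u x≢v = cong (lineScore D L) (σ-elsewhere x≢u x≢v)

        lineScore-twist-L : ∀ x → onLine L x ≡ true → lineScore D′ L x ≡ lineScore D L x
        lineScore-twist-L x x∈ = begin
          lineScore D′ L x
            ≡⟨ lineScore≡∑ D′ L x ⟩
          ∑[ w ∈ vertices ] (if onLine L w then ⟦ D′ x w ⟧ else 0)
            ≡⟨ ∑-cong vertices pointwise ⟩
          ∑[ w ∈ vertices ] (if onLine L (σ w) then ⟦ D (σ x) (σ w) ⟧ else 0)
            ≡⟨ ∑-involution {vertices} vertices-isListing σ σ-involutive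
                 (λ w → if onLine L w then ⟦ D (σ x) w ⟧ else 0) ⟩
          ∑[ w ∈ vertices ] (if onLine L w then ⟦ D (σ x) w ⟧ else 0)
            ≡⟨ sym (lineScore≡∑ D L (σ x)) ⟩
          lineScore D L (σ x)
            ≡⟨ lineScore-σ x ⟩
          lineScore D L x ∎
          where
          open ≡-Reasoning
          pointwise : ∀ w → (if onLine L w then ⟦ D′ x w ⟧ else 0)
                          ≡ (if onLine L (σ w) then ⟦ D (σ x) (σ w) ⟧ else 0)
          pointwise w = trans (if-then-0-cong (onLine L w) (cong ⟦_⟧ ∘ twist-on-L D x w x∈))
            (cong (λ c → if c then ⟦ D (σ x) (σ w) ⟧ else 0) (sym (onLine-σ w)))

        lineScore-twist-other : ∀ ℓ x → onLine ℓ x ≡ true → ¬ (∀ w → onLine ℓ w ≡ onLine L w) →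
          lineScore D′ ℓ x ≡ lineScore D ℓ x
        lineScore-twist-other ℓ x x∈ℓ ℓ≠L = trans (lineScore≡∑ D′ ℓ x) (trans
          (∑-cong vertices pointwise) (sym (lineScore≡∑ D ℓ x)))
          where
          pointwise : ∀ w → (if onLine ℓ w then ⟦ D′ x w ⟧ else 0) ≡ (if onLine ℓ w then ⟦ D x w ⟧ else 0)
          pointwise w with onLine ℓ w in w∈ℓ | pairSide x w
          ... | false | _ = refl
          ... | true | first-off x∉ = cong ⟦_⟧ (twist-offˡ D x w x∉)
          ... | true | second-off w∉ = cong ⟦_⟧ (twist-offʳ D x w w∉)
          ... | true | both-on x∈ w∈ with x ≟V w
          ...   | yes refl = cong ⟦_⟧ (trans (twist-on-L D x x x∈ x∈) (trans (irreflexive (σ x)) (sym (irreflexive x))))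
          ...   | no x≢w = contradiction (lines-meet-once ℓ L x≢w x∈ℓ w∈ℓ x∈ w∈) ℓ≠L

        balanced-twist : ∀ {e} → e ∈ edges r n → balanced D′ e ≡ balanced D e
        balanced-twist {a , b} e∈ = cong₂ _≡ᵇ_ (score-unchanged a a∈ℓ) (score-unchanged b b∈ℓ)
          where
          ab-adjacent = proj₁ (∧≡true (∈-edges⇒isEdge e∈))
          ℓ = lineThrough a b
          a∈ℓ = proj₁ (lineThrough-∋ a b ab-adjacent)
          b∈ℓ = proj₂ (lineThrough-∋ a b ab-adjacent)
          score-unchanged : ∀ x → onLine ℓ x ≡ true → lineScore D′ ℓ x ≡ lineScore D ℓ x
          score-unchanged x x∈ℓ with pairSide a b
          ... | both-on a∈ b∈ = trans (lineScore-cong D′ ℓ L ℓ≐L x)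
            (trans (lineScore-twist-L x (trans (sym (ℓ≐L x)) x∈ℓ)) (sym (lineScore-cong D ℓ L ℓ≐L x)))
            where ℓ≐L = lines-meet-once ℓ L (adjacent⇒≢ ab-adjacent) a∈ℓ b∈ℓ a∈ b∈
          ... | first-off a∉ = lineScore-twist-other ℓ x x∈ℓ λ ℓ≐L →
            contradiction (trans (sym a∈ℓ) (trans (ℓ≐L a) a∉)) λ ()
          ... | second-off b∉ = lineScore-twist-other ℓ x x∈ℓ λ ℓ≐L →
            contradiction (trans (sym b∈ℓ) (trans (ℓ≐L b) b∉)) λ ()

        firstBalancedEdge-twist : firstBalancedEdge D′ ≡ firstBalancedEdge D
        firstBalancedEdge-twist = findᵇ-cong (edges r n) balanced-twist

        outdegree-twist : ∀ x → ∑[ w ∈ vertices ] ⟦ D′ x w ⟧ ≡ ∑[ w ∈ vertices ] ⟦ D x w ⟧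
        outdegree-twist x with side x
        ... | off-L x∉ = ∑-cong vertices (λ w → cong ⟦_⟧ (twist-offˡ D x w x∉))
        ... | on-L x∈ = begin
          ∑[ w ∈ vertices ] ⟦ D′ x w ⟧
            ≡⟨ ∑-partition vertices (onLine L) _ ⟩
          (∑[ w ∈ vertices ] (if onLine L w then ⟦ D′ x w ⟧ else 0))
            + (∑[ w ∈ vertices ] (if onLine L w then 0 else ⟦ D′ x w ⟧))
            ≡⟨ cong₂ _+_ on-line (∑-cong vertices off-line) ⟩
          (∑[ w ∈ vertices ] (if onLine L w then ⟦ D x w ⟧ else 0))
            + (∑[ w ∈ vertices ] (if onLine L w then 0 else ⟦ D x w ⟧))
            ≡⟨ sym (∑-partition vertices (onLine L) _) ⟩
          ∑[ w ∈ vertices ] ⟦ D x w ⟧ ∎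
          where
          open ≡-Reasoning
          on-line = trans (sym (lineScore≡∑ D′ L x)) (trans (lineScore-twist-L x x∈) (lineScore≡∑ D L x))
          off-line : ∀ w → (if onLine L w then 0 else ⟦ D′ x w ⟧) ≡ (if onLine L w then 0 else ⟦ D x w ⟧)
          off-line w = if-0-else-cong (onLine L w) (cong ⟦_⟧ ∘ twist-offʳ D x w)

  balanced-cong : ∀ {D D′} → (∀ x y → D x y ≡ D′ x y) → ∀ e → balanced D e ≡ balanced D′ e
  balanced-cong {D} {D′} D≗D′ (a , b) = cong₂ _≡ᵇ_ (score-cong a) (score-cong b)
    where
    score-cong : ∀ x → lineScore D (lineThrough a b) x ≡ lineScore D′ (lineThrough a b) x
    score-cong x = ∑-cong (lineVertices (lineThrough a b)) (λ w → cong ⟦_⟧ (D≗D′ x w))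

  firstBalancedEdge-cong : ∀ {D D′} → (∀ x y → D x y ≡ D′ x y) → firstBalancedEdge D ≡ firstBalancedEdge D′
  firstBalancedEdge-cong D≗D′ = findᵇ-cong (edges r n) (λ {e} _ → balanced-cong D≗D′ e)

  -- The sign-reversing involution

  twistAt : Maybe Edge → Orientation r n → Orientation r n
  twistAt nothing o = o
  twistAt (just (u , v)) o = fromRelation (twist u v (arc o))

  involution : Orientation r n → Orientation r n
  involution o = twistAt (firstBalancedEdge (arc o)) o

  module AtBalancedEdge (o : Orientation r n) {u v} (first≡uv : firstBalancedEdge (arc o) ≡ just (u , v)) where

    uv-edge : (u , v) ∈ edges r n
    uv-edge = proj₁ (findᵇ-just (edges r n) first≡uv)

    uv-balanced : balanced (arc o) (u , v) ≡ true
    uv-balanced = proj₂ (findᵇ-just (edges r n) first≡uv)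

    uv-adjacent : adjacent u v ≡ true
    uv-adjacent = proj₁ (∧≡true (∈-edges⇒isEdge uv-edge))

    open Twisting u v uv-adjacent

    arc-involution : ∀ x y → arc (involution o) x y ≡ twist u v (arc o) x y
    arc-involution x y = trans (cong (λ k → arc (twistAt k o) x y) first≡uv)
      (arc-fromRelation (twist-isOrientation (arc-isOrientation o)) x y)

    firstBalancedEdge-involution : firstBalancedEdge (arc (involution o)) ≡ just (u , v)
    firstBalancedEdge-involution = trans (firstBalancedEdge-cong arc-involution)
      (trans (firstBalancedEdge-twist (arc-isOrientation o) uv-balanced) first≡uv)

    involution-involutive : involution (involution o) ≡ o
    involution-involutive = begin
      twistAt (firstBalancedEdge (arc (involution o))) (involution o)
        ≡⟨ cong (λ k → twistAt k (involution o)) firstBalancedEdge-involution ⟩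
      fromRelation (twist u v (arc (involution o)))
        ≡⟨ fromRelation-cong twice ⟩
      fromRelation (arc o)
        ≡⟨ fromRelation-arc o ⟩
      o ∎
      where
      open ≡-Reasoning
      twice : ∀ x y → twist u v (arc (involution o)) x y ≡ arc o x y
      twice x y = trans (twist-cong arc-involution x y) (twist-involutive (arc o) x y)

    outdeg-involution : ∀ w → outdeg (involution o) w ≡ outdeg o w
    outdeg-involution w = begin
      outdeg (involution o) w                       ≡⟨ outdeg≡∑-arc (involution o) w ⟩
      ∑[ x ∈ vertices ] ⟦ arc (involution o) w x ⟧  ≡⟨ ∑-cong vertices (λ x → cong ⟦_⟧ (arc-involution w x)) ⟩
      ∑[ x ∈ vertices ] ⟦ twist u v (arc o) w x ⟧   ≡⟨ outdegree-twist (arc-isOrientation o) uv-balanced w ⟩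
      ∑[ x ∈ vertices ] ⟦ arc o w x ⟧               ≡⟨ sym (outdeg≡∑-arc o w) ⟩
      outdeg o w                                    ∎
      where open ≡-Reasoning

    even-involution : evenOrientation (involution o) ≡ oddOrientation o
    even-involution = odd-sum⇒opposite-parity (inversions (involution o)) (inversions o) (proj₁ parity) (begin
      inversions (involution o) + inversions o
        ≡⟨ cong₂ _+_ (inversions≡inversionsOf (involution o)) (inversions≡inversionsOf o) ⟩
      inversionsOf (arc (involution o)) + inversionsOf (arc o)
        ≡⟨ cong (_+ inversionsOf (arc o))
             (∑²-cong (λ a b → cong (λ c → if isEdge a b then ⟦ c ⟧ else 0) (arc-involution b a))) ⟩
      inversionsOf (twist u v (arc o)) + inversionsOf (arc o)
        ≡⟨ proj₂ parity ⟩
      suc (proj₁ parity + proj₁ parity) ∎)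
      where
      open ≡-Reasoning
      parity = twist-flips-parity (arc-isOrientation o)

    cyclic : hasCyclicTriangleIn (arc o) ≡ true
    cyclic = balanced⇒cyclic (arc-isOrientation o) uv-adjacent uv-balanced

    cyclic-involution : hasCyclicTriangleIn (arc (involution o)) ≡ true
    cyclic-involution = balanced⇒cyclic (arc-isOrientation (involution o)) uv-adjacent
      (proj₂ (findᵇ-just (edges r n) firstBalancedEdge-involution))

  involution-unbalanced : ∀ {o} → firstBalancedEdge (arc o) ≡ nothing → involution o ≡ o
  involution-unbalanced {o} first≡ = cong (λ k → twistAt k o) first≡

  -- Matching on an equation instead of with-abstracting keeps involution o folded in the goal.
  involution-involutive : ∀ o → involution (involution o) ≡ o
  involution-involutive o = by-cases (firstBalancedEdge (arc o)) refl
    where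
    by-cases : ∀ k → firstBalancedEdge (arc o) ≡ k → involution (involution o) ≡ o
    by-cases nothing first≡ = trans (cong involution (involution-unbalanced first≡)) (involution-unbalanced first≡)
    by-cases (just _) first≡ = AtBalancedEdge.involution-involutive o first≡

  involution-even≡odd : ∀ d o →
    (evenOrientation (involution o) ∧ hasCyclicTriangle (involution o) ∧ hasOutdegrees d (involution o))
      ≡ (oddOrientation o ∧ hasCyclicTriangle o ∧ hasOutdegrees d o)
  involution-even≡odd d o = by-cases (firstBalancedEdge (arc o)) refl
    where
    by-cases : ∀ k → firstBalancedEdge (arc o) ≡ k →
      (evenOrientation (involution o) ∧ hasCyclicTriangle (involution o) ∧ hasOutdegrees d (involution o))
        ≡ (oddOrientation o ∧ hasCyclicTriangle o ∧ hasOutdegrees d o)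
    by-cases nothing first≡ = begin
      evenOrientation (involution o) ∧ hasCyclicTriangle (involution o) ∧ hasOutdegrees d (involution o)
        ≡⟨ cong (λ o′ → evenOrientation o′ ∧ hasCyclicTriangle o′ ∧ hasOutdegrees d o′)
             (involution-unbalanced first≡) ⟩
      evenOrientation o ∧ hasCyclicTriangle o ∧ hasOutdegrees d o
        ≡⟨ cong (evenOrientation o ∧_) acyclic ⟩
      evenOrientation o ∧ false
        ≡⟨ trans (∧-zeroʳ (evenOrientation o)) (sym (∧-zeroʳ (oddOrientation o))) ⟩
      oddOrientation o ∧ false
        ≡⟨ cong (oddOrientation o ∧_) (sym acyclic) ⟩
      oddOrientation o ∧ hasCyclicTriangle o ∧ hasOutdegrees d o ∎
      where
      open ≡-Reasoning
      acyclic : hasCyclicTriangle o ∧ hasOutdegrees d o ≡ false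
      acyclic = cong (_∧ hasOutdegrees d o) (no-balanced-edge⇒acyclic (arc-isOrientation o) first≡)
    by-cases (just (u , v)) first≡ = cong₂ _∧_ even-involution (cong₂ _∧_
      (trans cyclic-involution (sym cyclic))
      (all-cong vertices (λ w → cong (_≡ᵇ d w) (outdeg-involution w))))
      where open AtBalancedEdge o first≡

allVecs-isListing : ∀ m → Listing.IsListing (Vecₚ.≡-dec _≟𝔹_) (allVecs m)
allVecs-isListing zero [] = refl
allVecs-isListing (suc m) (c ∷ x) = begin
  ∑ (concatMap (λ b → map (b ∷_) (allVecs m)) (true ∷ false ∷ [])) (λ w → δ w (c ∷ x))
    ≡⟨ ∑-concatMap (true ∷ false ∷ []) (λ b → map (b ∷_) (allVecs m)) (λ w → δ w (c ∷ x)) ⟩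
  ∑[ b ∈ true ∷ false ∷ [] ] ∑ (map (b ∷_) (allVecs m)) (λ w → δ w (c ∷ x))
    ≡⟨ ∑-cong (true ∷ false ∷ []) extend ⟩
  ∑[ b ∈ true ∷ false ∷ [] ] δ𝔹 b c
    ≡⟨ count-Bool c ⟩
  1 ∎
  where
  open ≡-Reasoning
  open Listing _≟𝔹_ using () renaming (δ to δ𝔹)
  δ : ∀ {k} → Vec Bool k → Vec Bool k → ℕ
  δ = Listing.δ (Vecₚ.≡-dec _≟𝔹_)
  extend : ∀ b → ∑ (map (b ∷_) (allVecs m)) (λ w → δ w (c ∷ x)) ≡ δ𝔹 b c
  extend b = begin
    ∑ (map (b ∷_) (allVecs m)) (λ w → δ w (c ∷ x))   ≡⟨ ∑-map (allVecs m) (b ∷_) _ ⟩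
    ∑[ w ∈ allVecs m ] δ (b ∷ w) (c ∷ x)             ≡⟨ ∑-cong (allVecs m) (λ w → ⟦∧⟧ (does (b ≟𝔹 c)) _) ⟩
    ∑[ w ∈ allVecs m ] δ𝔹 b c * δ w x                ≡⟨ ∑-*ˡ (allVecs m) (δ𝔹 b c) _ ⟩
    δ𝔹 b c * (∑[ w ∈ allVecs m ] δ w x)              ≡⟨ cong (δ𝔹 b c *_) (allVecs-isListing m x) ⟩
    δ𝔹 b c * 1                                       ≡⟨ *-identityʳ (δ𝔹 b c) ⟩
    δ𝔹 b c                                           ∎
  count-Bool : ∀ c → ∑[ b ∈ true ∷ false ∷ [] ] δ𝔹 b c ≡ 1
  count-Bool true = refl
  count-Bool false = refl

numOrientations≡∑ : ∀ r n P → numOrientations r n P ≡ ∑[ w ∈ allVecs (length (edges r n)) ] ⟦ P (orient w) ⟧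
numOrientations≡∑ r n P =
  trans (length-filter (λ o → T? (P o)) (allOrientations r n)) (∑-map (allVecs (length (edges r n))) orient _)

lemma2p3 : (r n : ℕ) (δ : V r n → ℕ) →
    numOrientations r n (λ o → evenOrientation o ∧ hasCyclicTriangle o ∧ hasOutdegrees δ o)
      ≡ numOrientations r n (λ o → oddOrientation o ∧ hasCyclicTriangle o ∧ hasOutdegrees δ o)
lemma2p3 r n δ = begin
  numOrientations r n Even
    ≡⟨ numOrientations≡∑ r n Even ⟩
  ∑[ w ∈ bitVectors ] ⟦ Even (orient w) ⟧
    ≡⟨ sym (∑-involution {bitVectors} (allVecs-isListing _) involutionᵇ involutionᵇ-involutive _) ⟩
  ∑[ w ∈ bitVectors ] ⟦ Even (involution (orient w)) ⟧
    ≡⟨ ∑-cong bitVectors (λ w → cong ⟦_⟧ (involution-even≡odd δ (orient w))) ⟩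
  ∑[ w ∈ bitVectors ] ⟦ Odd (orient w) ⟧
    ≡⟨ sym (numOrientations≡∑ r n Odd) ⟩
  numOrientations r n Odd ∎
  where
  open ≡-Reasoning
  open Rectangle r n using (involution; involution-involutive; involution-even≡odd)
  open Listing (Vecₚ.≡-dec _≟𝔹_) using (∑-involution)
  Even Odd : Orientation r n → Bool
  Even o = evenOrientation o ∧ hasCyclicTriangle o ∧ hasOutdegrees δ o
  Odd o = oddOrientation o ∧ hasCyclicTriangle o ∧ hasOutdegrees δ o
  bitVectors = allVecs (length (edges r n))
  involutionᵇ : Vec Bool (length (edges r n)) → Vec Bool (length (edges r n))
  involutionᵇ w = dirs (involution (orient w))
  involutionᵇ-involutive : ∀ w → involutionᵇ (involutionᵇ w) ≡ w
  involutionᵇ-involutive w = cong dirs (involution-involutive (orient w))
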